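{- Let $A_1,\dots,A_n$ be finite multisets and $A=A_1\cup\cdots\cup A_n$. Let $T$ be a reduced mixing tree with leaves in $A$ of height $h(T)\ge2$, and let $T_1,\dots,T_r$ be the subtrees obtained by deleting the root of $T$. Let $c_1,\dots,c_r$ be gap-free colourings of $T_1,\dots,T_r$ respectively. Then $$\sum_{\substack{c\in\mathcal{C}_T\\ p_i(c)=c_i\ \forall i\in[r]}}(-1)^{|c|}=-\prod_{i=1}^r(-1)^{|c_i|}.$$
   Context: Elements of $A$ are regarded as distinguishable, each belonging to a specified $A_i$. A reduced tree with leaves in a set $B$ is a rooted tree with unordered children whose leaves are labelled bijectively by elements of $B$ (a one-vertex tree is a single leaf), each non-leaf vertex having at least two children; the subtrees obtained by deleting the root are the trees rooted at the children of the root. The height of a tree is the maximal distance from the root to a leaf. $T$ is mixing if for every vertex all of whose children are leaves, those children are labelled by elements belonging to at least two distinct multisets $A_i\ne A_j$. A gap-free colouring of a tree of length $r\ge0$ is a map from its vertices to $\{0,\dots,r\}$ using every colour, colouring every leaf $0$, with colours strictly decreasing from a vertex to each of its children; $|c|=r$. It is weakly-mixing if some vertex of colour $1$ has two children labelled by elements of two distinct multisets, or colour $1$ is unused; $\mathcal{C}_T$ is the set of gap-free weakly-mixing colourings of $T$. Projection: for a gap-free colouring $c$ of $T$, let $\bar c_i$ be its restriction to $T_i$, using colours $j_0<j_1<\cdots<j_l$; $p_i(c)$ is the gap-free colouring of $T_i$ obtained from $\bar c_i$ by replacing each colour $j_m$ by $m$. -}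

module Defs where

open import Data.Nat using (ℕ; zero; suc; _≤_; _<_; _⊔_)
open import Data.Nat.Properties using (_≟_; _<?_)
open import Data.Fin using (Fin)
open import Data.List using (List; []; _∷_; _++_; length; filter; deduplicate; foldr)
open import Data.List.Relation.Unary.All using (All)
open import Data.List.Relation.Unary.Any using (Any)
open import Data.List.Relation.Unary.Unique.Propositional using (Unique)
open import Data.List.Membership.Propositional using (_∈_)
open import Data.Product using (Σ; _×_; _,_; proj₁; proj₂; ∃₂)
open import Data.Sum using (_⊎_)
open import Data.Unit using (⊤)
open import Data.Empty using (⊥)
open import Data.Integer as ℤ using (ℤ)
open import Relation.Nullary using (¬_)
open import Relation.Binary.PropositionalEquality using (_≡_; _≢_)

-- Rooted trees with ordered lists of children (the order is irrelevant to
-- every notion below); leaves are labelled by elements of A = Fin m.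
data Tree (m : ℕ) : Set where
  leaf : Fin m → Tree m
  node : List (Tree m) → Tree m

module _ {m : ℕ} where

  mutual
    leaves : Tree m → List (Fin m)
    leaves (leaf a) = a ∷ []
    leaves (node ts) = leavesL ts

    leavesL : List (Tree m) → List (Fin m)
    leavesL [] = []
    leavesL (t ∷ ts) = leaves t ++ leavesL ts

  mutual
    height : Tree m → ℕ
    height (leaf _) = 0
    height (node ts) = suc (heightL ts)

    heightL : List (Tree m) → ℕ
    heightL [] = 0
    heightL (t ∷ ts) = height t ⊔ heightL ts

  mutual
    Reduced : Tree m → Set
    Reduced (leaf _) = ⊤
    Reduced (node ts) = 2 ≤ length ts × ReducedL ts

    ReducedL : List (Tree m) → Set
    ReducedL [] = ⊤
    ReducedL (t ∷ ts) = Reduced t × ReducedL ts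

  LeafBijective : Tree m → Set
  LeafBijective T = Unique (leaves T) × (∀ a → a ∈ leaves T)

  IsLeaf : Tree m → Set
  IsLeaf (leaf _) = ⊤
  IsLeaf (node _) = ⊥

  leafChildren : List (Tree m) → List (Fin m)
  leafChildren [] = []
  leafChildren (leaf a ∷ ts) = a ∷ leafChildren ts
  leafChildren (node _ ∷ ts) = leafChildren ts

  mutual
    internals : Tree m → List (List (Tree m))
    internals (leaf _) = []
    internals (node ts) = ts ∷ internalsL ts

    internalsL : List (Tree m) → List (List (Tree m))
    internalsL [] = []
    internalsL (t ∷ ts) = internals t ++ internalsL ts

  -- some two labels belong to distinct multisets A_i, A_j (i ≠ j)
  TwoClasses : {n : ℕ} → (Fin m → Fin n) → List (Fin m) → Set
  TwoClasses cls ls = ∃₂ λ a b → a ∈ ls × b ∈ ls × cls a ≢ cls b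

  Mixing : {n : ℕ} → (Fin m → Fin n) → Tree m → Set
  Mixing cls T =
    All (λ ts → All IsLeaf ts → TwoClasses cls (leafChildren ts)) (internals T)

  mutual
    data Col : Tree m → Set where
      cleaf : {a : Fin m} → ℕ → Col (leaf a)
      cnode : {ts : List (Tree m)} → ℕ → Cols ts → Col (node ts)

    data Cols : List (Tree m) → Set where
      [] : Cols []
      _∷_ : {t : Tree m} {ts : List (Tree m)} → Col t → Cols ts → Cols (t ∷ ts)

  colour : {T : Tree m} → Col T → ℕ
  colour (cleaf k) = k
  colour (cnode k _) = k

  mutual
    cvals : {T : Tree m} → Col T → List ℕ
    cvals (cleaf k) = k ∷ []
    cvals (cnode k cs) = k ∷ cvalsL cs

    cvalsL : {ts : List (Tree m)} → Cols ts → List ℕ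
    cvalsL [] = []
    cvalsL (c ∷ cs) = cvals c ++ cvalsL cs

  mutual
    Valid : {T : Tree m} → Col T → Set
    Valid (cleaf k) = k ≡ 0
    Valid (cnode k cs) = ValidL k cs

    ValidL : {ts : List (Tree m)} → ℕ → Cols ts → Set
    ValidL k [] = ⊤
    ValidL k (c ∷ cs) = colour c < k × Valid c × ValidL k cs

  GapFreeOfLength : {T : Tree m} → ℕ → Col T → Set
  GapFreeOfLength r c =
    Valid c × All (_≤ r) (cvals c) × (∀ k → k ≤ r → k ∈ cvals c)

  GapFree : {T : Tree m} → Col T → Set
  GapFree c = Σ ℕ λ r → GapFreeOfLength r c

  -- |c| : the largest colour used (= r for a gap-free colouring of length r)
  len : {T : Tree m} → Col T → ℕ
  len c = foldr _⊔_ 0 (cvals c)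

  mutual
    nodeData : {T : Tree m} → Col T → List (ℕ × List (Fin m))
    nodeData (cleaf _) = []
    nodeData (cnode {ts} k cs) = (k , leafChildren ts) ∷ nodeDataL cs

    nodeDataL : {ts : List (Tree m)} → Cols ts → List (ℕ × List (Fin m))
    nodeDataL [] = []
    nodeDataL (c ∷ cs) = nodeData c ++ nodeDataL cs

  WeaklyMixing : {n : ℕ} → (Fin m → Fin n) → {T : Tree m} → Col T → Set
  WeaklyMixing cls c =
    Any (λ p → proj₁ p ≡ 1 × TwoClasses cls (proj₂ p)) (nodeData c)
    ⊎ ¬ (1 ∈ cvals c)

  InC : {n : ℕ} → (Fin m → Fin n) → {T : Tree m} → Col T → Set
  InC cls c = GapFree c × WeaklyMixing cls c

  -- rank xs x = number of distinct colours in xs smaller than x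
  -- (so the m-th smallest colour j_m of xs is sent to m)
  rank : List ℕ → ℕ → ℕ
  rank xs x = length (deduplicate _≟_ (filter (_<? x) xs))

  mutual
    recolour : (ℕ → ℕ) → {T : Tree m} → Col T → Col T
    recolour f (cleaf k) = cleaf (f k)
    recolour f (cnode k cs) = cnode (f k) (recolourL f cs)

    recolourL : (ℕ → ℕ) → {ts : List (Tree m)} → Cols ts → Cols ts
    recolourL f [] = []
    recolourL f (c ∷ cs) = recolour f c ∷ recolourL f cs

  -- restriction to a subtree followed by the order-preserving compression
  normalise : {T : Tree m} → Col T → Col T
  normalise c = recolour (rank (cvals c)) c

  normaliseL : {ts : List (Tree m)} → Cols ts → Cols ts
  normaliseL [] = []
  normaliseL (c ∷ cs) = normalise c ∷ normaliseL cs

  projections : {ts : List (Tree m)} → Col (node ts) → Cols ts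
  projections (cnode _ cs) = normaliseL cs

  AllGapFree : {ts : List (Tree m)} → Cols ts → Set
  AllGapFree [] = ⊤
  AllGapFree (c ∷ cs) = GapFree c × AllGapFree cs

sgn : ℕ → ℤ
sgn zero = ℤ.+ 1
sgn (suc k) = ℤ.- sgn k

signedSum : {m : ℕ} {T : Tree m} → List (Col T) → ℤ
signedSum [] = ℤ.+ 0
signedSum (c ∷ cs) = sgn (len c) ℤ.+ signedSum cs

signProd : {m : ℕ} {ts : List (Tree m)} → Cols ts → ℤ
signProd [] = ℤ.+ 1
signProd (c ∷ cs) = sgn (len c) ℤ.* signProd cs

module Submission where

open import Defs
open import Data.Nat using (ℕ; _≤_)
open import Data.Fin using (Fin)
open import Data.List using (List; map)
open import Data.List.Relation.Unary.Unique.Propositional using (Unique)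
open import Data.List.Membership.Propositional using (_∈_)
open import Data.Product using (_×_; proj₂)
open import Data.Integer using (-_)
open import Function using (_∘_)
open import Function.Bundles using (_⇔_)
open import Relation.Binary.PropositionalEquality using (_≡_; sym; cong; module ≡-Reasoning)

-- A colouring c ∈ 𝒞_T with p(c) = cs is a root of colour h + 1 above a "lift" of cs:
-- a valid colouring of the forest ts of height h that uses each level 1, …, h and
-- projects to cs.  Conversely every lift under such a root lies in 𝒞_T: weak mixing is
-- automatic, since a vertex of colour 1 has only leaf children and T is mixing.  So the
-- sum is - Σ_{lifts of cs} (-1)^h, and the theorem reduces to the forest identity
-- Σ_{lifts of cs} (-1)^h = ∏ (-1)^|c_i|  (forestSum).  That identity is proved by
-- induction on the forest c₀ ∷ cs with a sign-reversing involution: take the lowest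
-- level of the first tree that is shared with the other trees or has a level below it
-- unused by the first tree; split it in the first case, merge it with the level below
-- in the second.  Split and merge undo each other and change the height by one; the
-- fixed points are c₀ next to the lifts of cs moved above the levels of c₀, which
-- contribute (-1)^|c₀| times the sum for cs.

-- Weighted sums over lists and the cancellation of a sign-reversing involution.
module SignedSums where

  open import Data.List using (List; []; _∷_; map; filter)
  import Data.List.Relation.Unary.All as All
  open import Data.List.Relation.Unary.AllPairs using ([]; _∷_)
  open import Data.List.Relation.Unary.Any using (here; there)
  open import Data.List.Relation.Unary.Unique.Propositional using (Unique)
  import Data.List.Relation.Unary.Unique.Propositional.Properties as Unique
  open import Data.List.Membership.Propositional using (_∈_)
  open import Data.List.Membership.Propositional.Properties
    using (∈-filter⁺; ∈-filter⁻; ∈-map⁺; ∈-map⁻)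
  open import Data.List.Membership.Propositional.Properties.WithK using (unique∧set⇒bag)
  open import Data.List.Relation.Binary.BagAndSetEquality using (∼bag⇒↭)
  open import Data.List.Relation.Binary.Permutation.Propositional as Perm using (_↭_)
  open import Data.Product using (_×_; _,_; proj₁; uncurry)
  open import Data.Nat using (zero; suc)
  open import Data.Integer as ℤ using (ℤ; _+_; _*_; -_; 0ℤ)
  import Data.Integer.Properties as ℤP
  open import Function using (_∘_)
  open import Function.Bundles using (_⇔_; mk⇔)
  open import Relation.Nullary using (¬_; Dec; yes; no; ¬?)
  open import Relation.Unary using (Decidable)
  open import Relation.Binary.Definitions using (DecidableEquality)
  open import Relation.Binary.PropositionalEquality

  sumOf : {X : Set} → (X → ℤ) → List X → ℤ
  sumOf w [] = 0ℤ
  sumOf w (x ∷ xs) = w x + sumOf w xs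

  module _ {X : Set} where

    sumOf-↭ : (w : X → ℤ) {xs ys : List X} → xs ↭ ys → sumOf w xs ≡ sumOf w ys
    sumOf-↭ w Perm.refl = refl
    sumOf-↭ w (Perm.prep x p) = cong (w x +_) (sumOf-↭ w p)
    sumOf-↭ w (Perm.swap {xs} {ys} x y p) = begin
        w x + (w y + sumOf w xs)  ≡⟨ sym (ℤP.+-assoc (w x) (w y) _) ⟩
        (w x + w y) + sumOf w xs  ≡⟨ cong₂ _+_ (ℤP.+-comm (w x) (w y)) (sumOf-↭ w p) ⟩
        (w y + w x) + sumOf w ys  ≡⟨ ℤP.+-assoc (w y) (w x) _ ⟩
        w y + (w x + sumOf w ys)  ∎
      where open ≡-Reasoning
    sumOf-↭ w (Perm.trans p q) = trans (sumOf-↭ w p) (sumOf-↭ w q)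

    sameMembers⇒↭ : {xs ys : List X} → Unique xs → Unique ys → (∀ z → z ∈ xs ⇔ z ∈ ys) → xs ↭ ys
    sameMembers⇒↭ !xs !ys same = ∼bag⇒↭ (unique∧set⇒bag !xs !ys (λ {z} → same z))

    sumOf-sameMembers : (w : X → ℤ) {xs ys : List X} → Unique xs → Unique ys →
      (∀ z → z ∈ xs ⇔ z ∈ ys) → sumOf w xs ≡ sumOf w ys
    sumOf-sameMembers w !xs !ys same =
      sumOf-↭ w (sameMembers⇒↭ !xs !ys same)

    sumOf-cong : {w v : X → ℤ} (xs : List X) → (∀ {x} → x ∈ xs → w x ≡ v x) →
      sumOf w xs ≡ sumOf v xs
    sumOf-cong [] _ = refl
    sumOf-cong (x ∷ xs) w≡v = cong₂ _+_ (w≡v (here refl)) (sumOf-cong xs (w≡v ∘ there))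

    sumOf-scale : (a : ℤ) (w : X → ℤ) (xs : List X) →
      sumOf (λ x → a * w x) xs ≡ a * sumOf w xs
    sumOf-scale a w [] = sym (ℤP.*-zeroʳ a)
    sumOf-scale a w (x ∷ xs) =
      trans (cong (a * w x +_) (sumOf-scale a w xs)) (sym (ℤP.*-distribˡ-+ a (w x) _))

    sumOf-neg : (w : X → ℤ) (xs : List X) → sumOf (λ x → - w x) xs ≡ - sumOf w xs
    sumOf-neg w [] = refl
    sumOf-neg w (x ∷ xs) =
      trans (cong (- w x +_) (sumOf-neg w xs)) (sym (ℤP.neg-distrib-+ (w x) _))

    sumOf-filter : (w : X → ℤ) {P : X → Set} (P? : Decidable P) (xs : List X) →
      sumOf w xs ≡ sumOf w (filter P? xs) + sumOf w (filter (¬? ∘ P?) xs)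
    sumOf-filter w P? [] = refl
    sumOf-filter w P? (x ∷ xs) with P? x
    ... | yes _ = trans (cong (w x +_) (sumOf-filter w P? xs)) (sym (ℤP.+-assoc (w x) _ _))
    ... | no _ = begin
        w x + sumOf w xs  ≡⟨ cong (w x +_) (sumOf-filter w P? xs) ⟩
        w x + (F + N)     ≡⟨ sym (ℤP.+-assoc (w x) F N) ⟩
        (w x + F) + N     ≡⟨ cong (_+ N) (ℤP.+-comm (w x) F) ⟩
        (F + w x) + N     ≡⟨ ℤP.+-assoc F (w x) N ⟩
        F + (w x + N)     ∎
      where
      open ≡-Reasoning
      F N : ℤ
      F = sumOf w (filter P? xs)
      N = sumOf w (filter (¬? ∘ P?) xs)

    map-unique : {Y : Set} (g : X → Y) (xs : List X) → Unique xs →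
      (∀ {x y} → x ∈ xs → y ∈ xs → g x ≡ g y → x ≡ y) → Unique (map g xs)
    map-unique g [] [] _ = []
    map-unique g (x ∷ xs) (x∉xs ∷ !xs) inj =
      All.tabulate (λ gy∈ gx≡gy → let (y , y∈ , gy≡) = ∈-map⁻ g gy∈ in
          All.lookup x∉xs y∈ (inj (here refl) (there y∈) (trans gx≡gy gy≡)))
      ∷ map-unique g xs !xs (λ p q → inj (there p) (there q))

  sumOf-map : {X Y : Set} (w : Y → ℤ) (g : X → Y) (xs : List X) →
    sumOf w (map g xs) ≡ sumOf (w ∘ g) xs
  sumOf-map w g [] = refl
  sumOf-map w g (x ∷ xs) = cong (w (g x) +_) (sumOf-map w g xs)

  self-neg⇒0 : ∀ (a : ℤ) → a ≡ - a → a ≡ 0ℤ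
  self-neg⇒0 (ℤ.+ zero) _ = refl
  self-neg⇒0 (ℤ.+ suc n) ()
  self-neg⇒0 ℤ.-[1+ n ] ()

  -- Sign-reversing involutions: if ι maps the members of a duplicate-free list to
  -- themselves, is an involution there and flips the weight of every non-fixed point,
  -- then the sum only sees the fixed points.  (ι permutes the non-fixed points, so
  -- their sum S satisfies S = -S.)
  module SignReversingInvolution {X : Set} (_≟_ : DecidableEquality X)
    (w : X → ℤ) (ι : X → X) where

    fixed? : (x : X) → Dec (ι x ≡ x)
    fixed? x = ι x ≟ x

    moved? : (x : X) → Dec (¬ ι x ≡ x)
    moved? = ¬? ∘ fixed?

    sum-fixedPoints : (xs : List X) → Unique xs →
      (∀ {x} → x ∈ xs → ι x ∈ xs) →
      (∀ {x} → x ∈ xs → ι (ι x) ≡ x) →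
      (∀ {x} → x ∈ xs → ι x ≢ x → w (ι x) ≡ - w x) →
      sumOf w xs ≡ sumOf w (filter fixed? xs)
    sum-fixedPoints xs !xs closed invol flip = begin
        sumOf w xs             ≡⟨ sumOf-filter w fixed? xs ⟩
        sumOf w F + sumOf w M  ≡⟨ cong (sumOf w F +_) movedSum≡0 ⟩
        sumOf w F + 0ℤ         ≡⟨ ℤP.+-identityʳ _ ⟩
        sumOf w F              ∎
      where
      open ≡-Reasoning
      F M : List X
      F = filter fixed? xs
      M = filter moved? xs
      inM : ∀ {x} → x ∈ M → x ∈ xs × ι x ≢ x
      inM = ∈-filter⁻ moved? {xs = xs}
      ι∈M : ∀ {x} → x ∈ M → ι x ∈ M
      ι∈M x∈ = let (x∈xs , moved) = inM x∈ in
        ∈-filter⁺ moved? (closed x∈xs) (λ e → moved (sym (trans (sym (invol x∈xs)) e)))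
      !M : Unique M
      !M = Unique.filter⁺ moved? !xs
      ι-permutesM : ∀ z → z ∈ M ⇔ z ∈ map ι M
      ι-permutesM z = mk⇔
        (λ z∈ → subst (_∈ map ι M) (invol (proj₁ (inM z∈))) (∈-map⁺ ι (ι∈M z∈)))
        (λ z∈ → let (x , x∈ , z≡) = ∈-map⁻ ι z∈ in subst (_∈ M) (sym z≡) (ι∈M x∈))
      !ιM : Unique (map ι M)
      !ιM = map-unique ι M !M (λ p q e →
        trans (sym (invol (proj₁ (inM p)))) (trans (cong ι e) (invol (proj₁ (inM q)))))
      movedSum≡0 : sumOf w M ≡ 0ℤ
      movedSum≡0 = self-neg⇒0 _ (begin
        sumOf w M              ≡⟨ sumOf-sameMembers w !M !ιM ι-permutesM ⟩
        sumOf w (map ι M)      ≡⟨ sumOf-map w ι M ⟩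
        sumOf (w ∘ ι) M        ≡⟨ sumOf-cong M (λ x∈ → uncurry flip (inM x∈)) ⟩
        sumOf (λ x → - w x) M  ≡⟨ sumOf-neg w M ⟩
        - sumOf w M            ∎)

module Levels where

  open import Data.Nat using (ℕ; zero; suc; pred; _+_; _∸_; _≤_; _<_; _⊔_; z≤n; s≤s; _≤?_; _<?_)
  open import Data.Nat.Properties
  open import Data.List using (List; []; _∷_; map; filter; foldr; length; deduplicate; downFrom)
  open import Data.List.Properties using (length-map; length-downFrom)
  open import Data.List.Relation.Unary.Any using (here; there)
  open import Data.List.Relation.Unary.Unique.Propositional using (Unique)
  import Data.List.Relation.Unary.Unique.Propositional.Properties as Unique
  open import Data.List.Relation.Unary.Unique.DecPropositional.Properties _≟_ using (deduplicate-!)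
  open import Data.List.Membership.Propositional using (_∈_)
  open import Data.List.Membership.Propositional.Properties
    using ( ∈-filter⁺; ∈-filter⁻; ∈-map⁺; ∈-map⁻; ∈-deduplicate⁺; ∈-deduplicate⁻
          ; ∈-downFrom⁺; ∈-downFrom⁻)
  open import Data.List.Relation.Binary.Permutation.Propositional.Properties using (↭-length)
  open import Data.Product using (_×_; _,_; proj₁; proj₂)
  open import Data.Sum using (_⊎_; inj₁; inj₂)
  open import Data.Empty using (⊥-elim)
  open import Function using (_∘_)
  open import Function.Bundles using (_⇔_; mk⇔; Equivalence)
  open import Relation.Nullary using (¬_; yes; no)
  open import Relation.Unary using (Decidable)
  open import Relation.Binary.Definitions using (tri<; tri≈; tri>)
  open import Relation.Binary.PropositionalEquality
  open SignedSums using (sameMembers⇒↭; map-unique)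

  -- The largest entry of a list (0 for the empty list); note len c = maxL (cvals c).
  maxL : List ℕ → ℕ
  maxL = foldr _⊔_ 0

  maxL-ub : ∀ {v} xs → v ∈ xs → v ≤ maxL xs
  maxL-ub (x ∷ xs) (here refl) = m≤m⊔n x (maxL xs)
  maxL-ub (x ∷ xs) (there v∈) = ≤-trans (maxL-ub xs v∈) (m≤n⊔m x (maxL xs))

  maxL-lub : ∀ {b} xs → (∀ {v} → v ∈ xs → v ≤ b) → maxL xs ≤ b
  maxL-lub [] _ = z≤n
  maxL-lub (x ∷ xs) ≤b = ⊔-lub (≤b (here refl)) (maxL-lub xs (≤b ∘ there))

  maxL-exact : ∀ {b} xs → (∀ {v} → v ∈ xs → v ≤ b) → b ∈ xs ⊎ b ≡ 0 → maxL xs ≡ b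
  maxL-exact xs ≤b (inj₁ b∈) = ≤-antisym (maxL-lub xs ≤b) (maxL-ub xs b∈)
  maxL-exact xs ≤b (inj₂ refl) = n≤0⇒n≡0 (maxL-lub xs ≤b)

  maxL-∈ : ∀ {v} xs → v ∈ xs → maxL xs ∈ xs
  maxL-∈ (x ∷ xs) _ = maxL-∈-∷ x xs
    where
    maxL-∈-∷ : ∀ x xs → maxL (x ∷ xs) ∈ x ∷ xs
    maxL-∈-∷ x [] = here (⊔-identityʳ x)
    maxL-∈-∷ x (y ∷ ys) with ⊔-sel x (maxL (y ∷ ys))
    ... | inj₁ max≡x = here max≡x
    ... | inj₂ max≡rest = there (subst (_∈ y ∷ ys) (sym max≡rest) (maxL-∈-∷ y ys))

  module LeastSearch {P : ℕ → Set} (P? : Decidable P) where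

    -- search s n is the least j ∈ [s, s + n) with P j, or s + n if there is none.
    search : ℕ → ℕ → ℕ
    search s zero = s
    search s (suc n) with P? s
    ... | yes _ = s
    ... | no _ = search (suc s) n

    search-≥ : ∀ s n → s ≤ search s n
    search-≥ s zero = ≤-refl
    search-≥ s (suc n) with P? s
    ... | yes _ = ≤-refl
    ... | no _ = <⇒≤ (search-≥ (suc s) n)

    search-miss : ∀ s n j → s ≤ j → j < search s n → ¬ P j
    search-miss s zero j s≤j j< = ⊥-elim (<-irrefl refl (≤-<-trans s≤j j<))
    search-miss s (suc n) j s≤j j< with P? s
    ... | yes _ = ⊥-elim (<-irrefl refl (≤-<-trans s≤j j<))
    ... | no ¬Ps with m≤n⇒m<n∨m≡n s≤j
    ...   | inj₁ s<j = search-miss (suc s) n j s<j j<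
    ...   | inj₂ refl = ¬Ps

    search-hit : ∀ s n → P (search s n) ⊎ search s n ≡ s + n
    search-hit s zero = inj₂ (sym (+-identityʳ s))
    search-hit s (suc n) with P? s
    ... | yes Ps = inj₁ Ps
    ... | no _ with search-hit (suc s) n
    ...   | inj₁ hit = inj₁ hit
    ...   | inj₂ end = inj₂ (trans end (sym (+-suc s n)))

    search-unique : ∀ s n a → s ≤ a → a < s + n → P a → (∀ j → s ≤ j → j < a → ¬ P j) →
      search s n ≡ a
    search-unique s n a s≤a a<end Pa least with <-cmp (search s n) a
    ... | tri≈ _ found _ = found
    ... | tri> _ _ a<found = ⊥-elim (search-miss s n a s≤a a<found Pa)
    ... | tri< found<a _ _ with search-hit s n
    ...   | inj₁ hit = ⊥-elim (least _ (search-≥ s n) found<a hit)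
    ...   | inj₂ end = ⊥-elim (<-asym a<end (subst (_< a) end found<a))

  below-or-above : ∀ q v → v < q ⊎ q ≤ v
  below-or-above q v with q ≤? v
  ... | yes q≤v = inj₂ q≤v
  ... | no q≰v = inj₁ (≰⇒> q≰v)

  -- raiseFrom q opens an empty level q: levels ≥ q move up by one.
  raiseFrom : ℕ → ℕ → ℕ
  raiseFrom q v with q ≤? v
  ... | yes _ = suc v
  ... | no _ = v

  -- lowerFrom q moves levels ≥ q down by one (so level q is merged into level q - 1).
  lowerFrom : ℕ → ℕ → ℕ
  lowerFrom q v with q ≤? v
  ... | yes _ = pred v
  ... | no _ = v

  raise-below : ∀ {q v} → v < q → raiseFrom q v ≡ v
  raise-below {q} {v} v<q with q ≤? v
  ... | yes q≤v = ⊥-elim (<-irrefl refl (<-≤-trans v<q q≤v))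
  ... | no _ = refl

  raise-above : ∀ {q v} → q ≤ v → raiseFrom q v ≡ suc v
  raise-above {q} {v} q≤v with q ≤? v
  ... | yes _ = refl
  ... | no q≰v = ⊥-elim (q≰v q≤v)

  lower-below : ∀ {q v} → v < q → lowerFrom q v ≡ v
  lower-below {q} {v} v<q with q ≤? v
  ... | yes q≤v = ⊥-elim (<-irrefl refl (<-≤-trans v<q q≤v))
  ... | no _ = refl

  lower-above : ∀ {q v} → q ≤ v → lowerFrom q v ≡ pred v
  lower-above {q} {v} q≤v with q ≤? v
  ... | yes _ = refl
  ... | no q≰v = ⊥-elim (q≰v q≤v)

  raise-mono : ∀ q {u v} → u < v → raiseFrom q u < raiseFrom q v
  raise-mono q {u} {v} u<v with below-or-above q u | below-or-above q v
  ... | inj₁ u<q | inj₁ v<q rewrite raise-below u<q | raise-below v<q = u<v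
  ... | inj₁ u<q | inj₂ q≤v rewrite raise-below u<q | raise-above q≤v = m≤n⇒m≤1+n u<v
  ... | inj₂ q≤u | inj₁ v<q = ⊥-elim (<-asym (≤-<-trans q≤u u<v) v<q)
  ... | inj₂ q≤u | inj₂ q≤v rewrite raise-above q≤u | raise-above q≤v = s≤s u<v

  raise-≤suc : ∀ q v → raiseFrom q v ≤ suc v
  raise-≤suc q v with below-or-above q v
  ... | inj₁ v<q rewrite raise-below v<q = n≤1+n v
  ... | inj₂ q≤v rewrite raise-above q≤v = ≤-refl

  raise-misses : ∀ q v → raiseFrom q v ≢ q
  raise-misses q v with below-or-above q v
  ... | inj₁ v<q rewrite raise-below v<q = <⇒≢ v<q
  ... | inj₂ q≤v rewrite raise-above q≤v = λ v+1≡q → <-irrefl (sym v+1≡q) (s≤s q≤v)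

  lower-mono : ∀ q {u v} → u ≢ q → v ≢ q → u < v → lowerFrom (suc q) u < lowerFrom (suc q) v
  lower-mono q {u} {v} u≢q v≢q u<v with below-or-above (suc q) u | below-or-above (suc q) v
  ... | inj₁ u≤q | inj₁ v≤q rewrite lower-below u≤q | lower-below v≤q = u<v
  ... | inj₁ u≤q | inj₂ q<v rewrite lower-below u≤q | lower-above q<v =
    <-≤-trans (≤∧≢⇒< (≤-pred u≤q) u≢q) (pred-mono-≤ q<v)
  ... | inj₂ q<u | inj₁ v≤q = ⊥-elim (<-asym (≤-<-trans q<u u<v) v≤q)
  lower-mono q {suc u} {suc v} _ _ (s≤s u<v) | inj₂ q<u | inj₂ q<v
    rewrite lower-above q<u | lower-above q<v = u<v

  lower-raise : ∀ q v → lowerFrom (suc q) (raiseFrom q v) ≡ v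
  lower-raise q v with below-or-above q v
  ... | inj₁ v<q rewrite raise-below v<q = lower-below (m≤n⇒m≤1+n v<q)
  ... | inj₂ q≤v rewrite raise-above q≤v = lower-above (s≤s q≤v)

  raise-lower : ∀ q v → v ≢ q → raiseFrom q (lowerFrom (suc q) v) ≡ v
  raise-lower q v v≢q with below-or-above (suc q) v
  ... | inj₁ v≤q rewrite lower-below v≤q = raise-below (≤∧≢⇒< (≤-pred v≤q) v≢q)
  raise-lower q (suc v) _ | inj₂ q<v rewrite lower-above q<v = raise-above (≤-pred q<v)

  lower-≤pred : ∀ {q v R} → v ≤ R → (v < q → v < R) → lowerFrom q v ≤ pred R
  lower-≤pred {q} {v} v≤R lt with below-or-above q v
  ... | inj₁ v<q rewrite lower-below v<q = <⇒≤pred (lt v<q)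
  ... | inj₂ q≤v rewrite lower-above q≤v = pred-mono-≤ v≤R

  liftAbove : ℕ → ℕ → ℕ
  liftAbove r zero = zero
  liftAbove r (suc v) = r + suc v

  liftAbove-mono : ∀ r {u v} → u < v → liftAbove r u < liftAbove r v
  liftAbove-mono r {zero} {suc v} _ = ≤-trans (s≤s z≤n) (m≤n+m (suc v) r)
  liftAbove-mono r {suc u} {suc v} u<v = +-monoʳ-< r u<v

  liftAbove-∸ : ∀ r v → liftAbove r v ∸ r ≡ v
  liftAbove-∸ r zero = 0∸n≡0 r
  liftAbove-∸ r (suc v) = m+n∸m≡n r (suc v)

  ∸-liftAbove : ∀ r v → v ≡ 0 ⊎ r < v → liftAbove r (v ∸ r) ≡ v
  ∸-liftAbove r .zero (inj₁ refl) = cong (liftAbove r) (0∸n≡0 r)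
  ∸-liftAbove r v (inj₂ r<v) with v ∸ r in v∸r≡
  ... | zero = ⊥-elim (<-irrefl refl (<-≤-trans r<v (m∸n≡0⇒m≤n v∸r≡)))
  ... | suc _ = trans (cong (r +_) (sym v∸r≡)) (m+[n∸m]≡n (<⇒≤ r<v))

  liftAbove-range : ∀ r u → liftAbove r u ≡ 0 ⊎ r < liftAbove r u
  liftAbove-range r zero = inj₁ refl
  liftAbove-range r (suc u) = inj₂ (m<m+n r (s≤s z≤n))

  liftAbove-≤ : ∀ r u → liftAbove r u ≤ r + u
  liftAbove-≤ r zero = z≤n
  liftAbove-≤ r (suc u) = ≤-refl

  MonoOn : (ℕ → ℕ) → List ℕ → Set
  MonoOn f xs = ∀ {u v} → u ∈ xs → v ∈ xs → u < v → f u < f v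

  MonoOn-⊆ : ∀ {f xs ys} → (∀ {z} → z ∈ xs → z ∈ ys) → MonoOn f ys → MonoOn f xs
  MonoOn-⊆ xs⊆ys mono u∈ v∈ = mono (xs⊆ys u∈) (xs⊆ys v∈)

  MonoOn⇒injective : ∀ {f xs u v} → MonoOn f xs → u ∈ xs → v ∈ xs → f u ≡ f v → u ≡ v
  MonoOn⇒injective mono u∈ v∈ fu≡fv with <-cmp _ _
  ... | tri< u<v _ _ = ⊥-elim (<-irrefl fu≡fv (mono u∈ v∈ u<v))
  ... | tri≈ _ u≡v _ = u≡v
  ... | tri> _ _ v<u = ⊥-elim (<-irrefl (sym fu≡fv) (mono v∈ u∈ v<u))

  AgreeBelow : ℕ → List ℕ → List ℕ → Set
  AgreeBelow q A B = ∀ {j} → j < q → j ∈ A ⇔ j ∈ B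

  AgreeBelow-≤ : ∀ {q q′ A B} → q ≤ q′ → AgreeBelow q′ A B → AgreeBelow q A B
  AgreeBelow-≤ q≤q′ A≈B j<q = A≈B (<-≤-trans j<q q≤q′)

  map-agreeBelow : ∀ (f : ℕ → ℕ) {q′ q} (V : List ℕ) → q′ ≤ q →
    (∀ {v} → v < q → f v ≡ v) → (∀ {v} → q ≤ v → q′ ≤ f v) → AgreeBelow q′ (map f V) V
  map-agreeBelow f V q′≤q fixes moves {j} j<q′ = mk⇔ fromImage
    (λ j∈ → subst (_∈ map f V) (fixes (<-≤-trans j<q′ q′≤q)) (∈-map⁺ f j∈))
    where
    fromImage : j ∈ map f V → j ∈ V
    fromImage j∈ with ∈-map⁻ f j∈
    ... | v , v∈ , j≡fv with below-or-above _ v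
    ...   | inj₁ v<q = subst (_∈ V) (sym (trans j≡fv (fixes v<q))) v∈
    ...   | inj₂ q≤v = ⊥-elim (<-irrefl j≡fv (<-≤-trans j<q′ (moves q≤v)))

  raise-agreeBelow : ∀ q V → AgreeBelow q (map (raiseFrom q) V) V
  raise-agreeBelow q V = map-agreeBelow (raiseFrom q) V ≤-refl raise-below
    (λ {v} q≤v → ≤-trans q≤v (subst (v ≤_) (sym (raise-above q≤v)) (n≤1+n v)))

  lower-agreeBelow : ∀ q V → AgreeBelow q (map (lowerFrom (suc q)) V) V
  lower-agreeBelow q V = map-agreeBelow (lowerFrom (suc q)) V (n≤1+n q) lower-below
    (λ q<v → subst (_ ≤_) (sym (lower-above q<v)) (pred-mono-≤ q<v))

  -- rank xs x can be computed from any duplicate-free list of the levels of xs below x.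
  -- (rank does not depend on its implicit tree parameter, which we fix to 0.)
  rank-by-members : (xs : List ℕ) (x : ℕ) (U : List ℕ) → Unique U →
    (∀ z → z ∈ U ⇔ (z ∈ xs × z < x)) → rank {0} xs x ≡ length U
  rank-by-members xs x U !U members = ↭-length (sameMembers⇒↭ (deduplicate-! _) !U λ z → mk⇔
    (λ z∈ → Equivalence.from (members z) (∈-filter⁻ (_<? x) {xs = xs} (∈-deduplicate⁻ _≟_ _ z∈)))
    (λ z∈ → let (z∈xs , z<x) = Equivalence.to (members z) z∈ in
      ∈-deduplicate⁺ _≟_ (∈-filter⁺ (_<? x) z∈xs z<x)))

  rank-initialSegment : (xs : List ℕ) (k : ℕ) → (∀ {u} → u ∈ xs → u ≤ k) → (∀ {u} → u ≤ k → u ∈ xs) →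
    ∀ {v} → v ≤ k → rank {0} xs v ≡ v
  rank-initialSegment xs k ≤k segment {v} v≤k =
    trans (rank-by-members xs v (downFrom v) (Unique.downFrom⁺ v) (λ z → mk⇔
      (λ z∈ → let z<v = ∈-downFrom⁻ z∈ in segment (<⇒≤ (<-≤-trans z<v v≤k)) , z<v)
      (∈-downFrom⁺ ∘ proj₂)))
    (length-downFrom v)

  rank-map : (f : ℕ → ℕ) (xs : List ℕ) → MonoOn f xs → ∀ {v} → v ∈ xs →
    rank {0} (map f xs) (f v) ≡ rank {0} xs v
  rank-map f xs mono {v} v∈ = trans (rank-by-members (map f xs) (f v) (map f D) !fD members)
    (length-map f D)
    where
    D : List ℕ
    D = deduplicate _≟_ (filter (_<? v) xs)
    inD : ∀ {u} → u ∈ D → u ∈ xs × u < v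
    inD u∈ = ∈-filter⁻ (_<? v) {xs = xs} (∈-deduplicate⁻ _≟_ _ u∈)
    !fD : Unique (map f D)
    !fD = map-unique f D (deduplicate-! _) λ p q → MonoOn⇒injective mono (proj₁ (inD p)) (proj₁ (inD q))
    members : ∀ z → z ∈ map f D ⇔ (z ∈ map f xs × z < f v)
    members z = mk⇔
      (λ z∈ → let (u , u∈ , z≡) = ∈-map⁻ f z∈ ; (u∈xs , u<v) = inD u∈ in
        subst (_∈ map f xs) (sym z≡) (∈-map⁺ f u∈xs) , subst (_< f v) (sym z≡) (mono u∈xs v∈ u<v))
      (λ (z∈ , z<fv) → let (u , u∈xs , z≡) = ∈-map⁻ f z∈ in
        subst (_∈ map f D) (sym z≡) (∈-map⁺ f (∈-deduplicate⁺ _≟_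
          (∈-filter⁺ (_<? v) u∈xs (below u∈xs (subst (_< f v) z≡ z<fv))))))
      where
      below : ∀ {u} → u ∈ xs → f u < f v → u < v
      below {u} u∈ fu<fv with <-cmp u v
      ... | tri< u<v _ _ = u<v
      ... | tri≈ _ refl _ = ⊥-elim (<-irrefl refl fu<fv)
      ... | tri> _ _ v<u = ⊥-elim (<-asym fu<fv (mono v∈ u∈ v<u))

module Colourings where

  open import Data.Nat using (ℕ; _≤_; _<_; _≟_)
  open import Data.Nat.Properties using (≤-refl; <⇒≤; ≤-<-trans)
  open import Data.List using (List; []; _∷_; _++_; map)
  open import Data.List.Properties using (map-++)
  import Data.List.Relation.Unary.All as All
  open import Data.List.Relation.Unary.Any using (here; there)
  open import Data.List.Membership.Propositional using (_∈_)
  open import Data.List.Membership.Propositional.Properties using (∈-++⁺ˡ; ∈-++⁺ʳ; ∈-++⁻)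
  open import Data.Product using (_×_; _,_)
  open import Data.Sum using (inj₁; inj₂)
  open import Data.Unit using (⊤; tt)
  open import Function using (_∘_)
  open import Relation.Nullary using (yes; no)
  open import Relation.Binary.Definitions using (DecidableEquality)
  open import Relation.Binary.PropositionalEquality
  open Levels

  module _ {m : ℕ} where

    colour∈cvals : {T : Tree m} (c : Col T) → colour c ∈ cvals c
    colour∈cvals (cleaf _) = here refl
    colour∈cvals (cnode _ _) = here refl

    colour-recolour : (f : ℕ → ℕ) {T : Tree m} (c : Col T) → colour (recolour f c) ≡ f (colour c)
    colour-recolour f (cleaf _) = refl
    colour-recolour f (cnode _ _) = refl

    mutual
      cvals-recolour : (f : ℕ → ℕ) {T : Tree m} (c : Col T) → cvals (recolour f c) ≡ map f (cvals c)
      cvals-recolour f (cleaf k) = refl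
      cvals-recolour f (cnode k cs) = cong (f k ∷_) (cvalsL-recolour f cs)

      cvalsL-recolour : (f : ℕ → ℕ) {ts : List (Tree m)} (cs : Cols ts) →
        cvalsL (recolourL f cs) ≡ map f (cvalsL cs)
      cvalsL-recolour f [] = refl
      cvalsL-recolour f (c ∷ cs) =
        trans (cong₂ _++_ (cvals-recolour f c) (cvalsL-recolour f cs)) (sym (map-++ f (cvals c) (cvalsL cs)))

    mutual
      recolour-cong : {f g : ℕ → ℕ} {T : Tree m} (c : Col T) →
        (∀ {v} → v ∈ cvals c → f v ≡ g v) → recolour f c ≡ recolour g c
      recolour-cong (cleaf k) f≡g = cong cleaf (f≡g (here refl))
      recolour-cong (cnode k cs) f≡g = cong₂ cnode (f≡g (here refl)) (recolourL-cong cs (f≡g ∘ there))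

      recolourL-cong : {f g : ℕ → ℕ} {ts : List (Tree m)} (cs : Cols ts) →
        (∀ {v} → v ∈ cvalsL cs → f v ≡ g v) → recolourL f cs ≡ recolourL g cs
      recolourL-cong [] _ = refl
      recolourL-cong (c ∷ cs) f≡g =
        cong₂ _∷_ (recolour-cong c (f≡g ∘ ∈-++⁺ˡ)) (recolourL-cong cs (f≡g ∘ ∈-++⁺ʳ (cvals c)))

    mutual
      recolour-id : {T : Tree m} (c : Col T) → recolour (λ v → v) c ≡ c
      recolour-id (cleaf k) = refl
      recolour-id (cnode k cs) = cong (cnode k) (recolourL-id cs)

      recolourL-id : {ts : List (Tree m)} (cs : Cols ts) → recolourL (λ v → v) cs ≡ cs
      recolourL-id [] = refl
      recolourL-id (c ∷ cs) = cong₂ _∷_ (recolour-id c) (recolourL-id cs)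

    mutual
      recolour-∘ : (f g : ℕ → ℕ) {T : Tree m} (c : Col T) → recolour f (recolour g c) ≡ recolour (f ∘ g) c
      recolour-∘ f g (cleaf k) = refl
      recolour-∘ f g (cnode k cs) = cong (cnode (f (g k))) (recolourL-∘ f g cs)

      recolourL-∘ : (f g : ℕ → ℕ) {ts : List (Tree m)} (cs : Cols ts) →
        recolourL f (recolourL g cs) ≡ recolourL (f ∘ g) cs
      recolourL-∘ f g [] = refl
      recolourL-∘ f g (c ∷ cs) = cong₂ _∷_ (recolour-∘ f g c) (recolourL-∘ f g cs)

    recolourL-inverse : (f g : ℕ → ℕ) {ts : List (Tree m)} (cs : Cols ts) →
      (∀ {v} → v ∈ cvalsL cs → g (f v) ≡ v) → recolourL g (recolourL f cs) ≡ cs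
    recolourL-inverse f g cs gf≡id =
      trans (recolourL-∘ g f cs) (trans (recolourL-cong cs gf≡id) (recolourL-id cs))

    recolour-inverse : (f g : ℕ → ℕ) {T : Tree m} (c : Col T) →
      (∀ {v} → v ∈ cvals c → g (f v) ≡ v) → recolour g (recolour f c) ≡ c
    recolour-inverse f g c gf≡id =
      trans (recolour-∘ g f c) (trans (recolour-cong c gf≡id) (recolour-id c))

    ValidAll : {ts : List (Tree m)} → Cols ts → Set
    ValidAll [] = ⊤
    ValidAll (c ∷ cs) = Valid c × ValidAll cs

    mutual
      Valid-recolour : (f : ℕ → ℕ) → f 0 ≡ 0 → {T : Tree m} (c : Col T) →
        MonoOn f (cvals c) → Valid c → Valid (recolour f c)
      Valid-recolour f f0 (cleaf k) _ k≡0 = trans (cong f k≡0) f0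
      Valid-recolour f f0 (cnode k cs) mono valid = ValidL-recolour f f0 k cs mono valid

      ValidL-recolour : (f : ℕ → ℕ) → f 0 ≡ 0 → (k : ℕ) {ts : List (Tree m)} (cs : Cols ts) →
        MonoOn f (k ∷ cvalsL cs) → ValidL k cs → ValidL (f k) (recolourL f cs)
      ValidL-recolour f f0 k [] _ _ = tt
      ValidL-recolour f f0 k (c ∷ cs) mono (c<k , vc , vcs) =
        subst (_< f k) (sym (colour-recolour f c)) (mono (there (∈-++⁺ˡ (colour∈cvals c))) (here refl) c<k) ,
        Valid-recolour f f0 c (MonoOn-⊆ (there ∘ ∈-++⁺ˡ) mono) vc ,
        ValidL-recolour f f0 k cs
          (MonoOn-⊆ (λ { (here e) → here e ; (there p) → there (∈-++⁺ʳ (cvals c) p) }) mono) vcs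

    ValidAll-recolour : (f : ℕ → ℕ) → f 0 ≡ 0 → {ts : List (Tree m)} (cs : Cols ts) →
      MonoOn f (cvalsL cs) → ValidAll cs → ValidAll (recolourL f cs)
    ValidAll-recolour f f0 [] _ _ = tt
    ValidAll-recolour f f0 (c ∷ cs) mono (vc , vcs) =
      Valid-recolour f f0 c (MonoOn-⊆ ∈-++⁺ˡ mono) vc ,
      ValidAll-recolour f f0 cs (MonoOn-⊆ (∈-++⁺ʳ (cvals c)) mono) vcs

    mutual
      Valid-≤root : {T : Tree m} (c : Col T) → Valid c → ∀ {v} → v ∈ cvals c → v ≤ colour c
      Valid-≤root (cleaf k) _ (here refl) = ≤-refl
      Valid-≤root (cnode k cs) _ (here refl) = ≤-refl
      Valid-≤root (cnode k cs) valid (there v∈) = <⇒≤ (ValidL-<root k cs valid v∈)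

      ValidL-<root : (k : ℕ) {ts : List (Tree m)} (cs : Cols ts) → ValidL k cs →
        ∀ {v} → v ∈ cvalsL cs → v < k
      ValidL-<root k (c ∷ cs) (c<k , vc , vcs) v∈ with ∈-++⁻ (cvals c) v∈
      ... | inj₁ v∈c = ≤-<-trans (Valid-≤root c vc v∈c) c<k
      ... | inj₂ v∈cs = ValidL-<root k cs vcs v∈cs

    0∈cvals : {T : Tree m} (c : Col T) → Reduced T → Valid c → 0 ∈ cvals c
    0∈cvals (cleaf k) _ k≡0 = here (sym k≡0)
    0∈cvals (cnode k (c ∷ cs)) (_ , rc , _) (_ , vc , _) = there (∈-++⁺ˡ (0∈cvals c rc vc))
    0∈cvals (cnode k []) (() , _) _

    normalise-recolour : (f : ℕ → ℕ) {T : Tree m} (c : Col T) → MonoOn f (cvals c) →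
      normalise (recolour f c) ≡ normalise c
    normalise-recolour f c mono = begin
      recolour (rank {0} (cvals (recolour f c))) (recolour f c)
        ≡⟨ cong (λ l → recolour (rank {0} l) (recolour f c)) (cvals-recolour f c) ⟩
      recolour (rank {0} (map f (cvals c))) (recolour f c)
        ≡⟨ recolour-∘ _ f c ⟩
      recolour (rank {0} (map f (cvals c)) ∘ f) c
        ≡⟨ recolour-cong c (rank-map f (cvals c) mono) ⟩
      recolour (rank {0} (cvals c)) c
        ∎
      where open ≡-Reasoning

    normaliseL-recolour : (f : ℕ → ℕ) {ts : List (Tree m)} (cs : Cols ts) → MonoOn f (cvalsL cs) →
      normaliseL (recolourL f cs) ≡ normaliseL cs
    normaliseL-recolour f [] _ = refl
    normaliseL-recolour f (c ∷ cs) mono = cong₂ _∷_ (normalise-recolour f c (MonoOn-⊆ ∈-++⁺ˡ mono))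
      (normaliseL-recolour f cs (MonoOn-⊆ (∈-++⁺ʳ (cvals c)) mono))

    normalise-initialSegment : {T : Tree m} (c : Col T) (k : ℕ) →
      (∀ {u} → u ∈ cvals c → u ≤ k) → (∀ {u} → u ≤ k → u ∈ cvals c) → normalise c ≡ c
    normalise-initialSegment c k ≤k segment = trans
      (recolour-cong c (λ v∈ → rank-initialSegment (cvals c) k ≤k segment (≤k v∈))) (recolour-id c)

    gapFree-len : {T : Tree m} (c : Col T) (r : ℕ) → GapFreeOfLength r c → len c ≡ r
    gapFree-len c r (_ , ≤r , uses) = maxL-exact (cvals c) (All.lookup ≤r) (inj₁ (uses r ≤-refl))

    gapFree-normalise : {T : Tree m} (c : Col T) → GapFree c → normalise c ≡ c
    gapFree-normalise c (r , _ , ≤r , uses) = normalise-initialSegment c r (All.lookup ≤r) (uses _)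

    mutual
      _≟Col_ : {T : Tree m} → DecidableEquality (Col T)
      cleaf k ≟Col cleaf k′ with k ≟ k′
      ... | yes refl = yes refl
      ... | no k≢k′ = no λ { refl → k≢k′ refl }
      cnode k cs ≟Col cnode k′ cs′ with k ≟ k′ | cs ≟Cols cs′
      ... | yes refl | yes refl = yes refl
      ... | no k≢k′ | _ = no λ { refl → k≢k′ refl }
      ... | _ | no cs≢cs′ = no λ { refl → cs≢cs′ refl }

      _≟Cols_ : {ts : List (Tree m)} → DecidableEquality (Cols ts)
      [] ≟Cols [] = yes refl
      (c ∷ cs) ≟Cols (c′ ∷ cs′) with c ≟Col c′ | cs ≟Cols cs′
      ... | yes refl | yes refl = yes refl
      ... | no c≢c′ | _ = no λ { refl → c≢c′ refl }
      ... | _ | no cs≢cs′ = no λ { refl → cs≢cs′ refl }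

-- Level sets of a forest colouring: the first tree (Y) against the others (Z).
module LevelSets where

  open import Data.Nat using (ℕ; zero; suc; pred; _+_; _∸_; _≤_; _<_; z≤n; s≤s; _≟_; _≤?_; >-nonZero)
  open import Data.Nat.Properties
  open import Data.List using (List; map)
  open import Data.List.Membership.Propositional using (_∈_; _∉_)
  open import Data.List.Membership.DecPropositional _≟_ using (_∈?_)
  open import Data.List.Membership.Propositional.Properties using (∈-map⁺; ∈-map⁻)
  open import Data.Product using (_×_; _,_; proj₁; proj₂)
  open import Data.Sum using (_⊎_; inj₁; inj₂)
  open import Data.Empty using (⊥-elim)
  open import Function.Bundles using (Equivalence)
  open import Relation.Nullary using (¬_; ¬?; yes; no; _×-dec_; _⊎-dec_)
  open import Relation.Nullary.Decidable using (decidable-stable)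
  open import Relation.Unary using (Decidable)
  open import Relation.Binary.Definitions using (tri<; tri≈; tri>)
  open import Relation.Binary.PropositionalEquality
  open Levels

  record Cover (Y Z : List ℕ) (R : ℕ) : Set where
    field
      0∈Y : 0 ∈ Y
      Y≤R : ∀ {v} → v ∈ Y → v ≤ R
      Z≤R : ∀ {v} → v ∈ Z → v ≤ R
      covered : ∀ {j} → suc j ≤ R → suc j ∈ Y ⊎ suc j ∈ Z

  Movable : List ℕ → List ℕ → ℕ → Set
  Movable Y Z j = suc j ∈ Y × (suc j ∈ Z ⊎ j ∉ Y)

  movable? : ∀ Y Z → Decidable (Movable Y Z)
  movable? Y Z j = (suc j ∈? Y) ×-dec ((suc j ∈? Z) ⊎-dec ¬? (j ∈? Y))

  IsLowestMovable : List ℕ → List ℕ → ℕ → Set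
  IsLowestMovable Y Z g = Movable Y Z g × (∀ j → j < g → ¬ Movable Y Z j)

  open LeastSearch using (search; search-hit; search-miss; search-unique)

  -- The involution acts at the lowest movable level (or is the identity if there is none).
  lowestMovable : List ℕ → List ℕ → ℕ
  lowestMovable Y Z = search (movable? Y Z) 0 (maxL Y)

  lowestMovable-unique : ∀ {Y Z g} → IsLowestMovable Y Z g → lowestMovable Y Z ≡ g
  lowestMovable-unique {Y} {Z} {g} (mov , least) =
    search-unique (movable? Y Z) 0 (maxL Y) g z≤n (maxL-ub Y (proj₁ mov)) mov (λ j _ → least j)

  lowestMovable-found : ∀ Y Z → suc (lowestMovable Y Z) ∈ Y → IsLowestMovable Y Z (lowestMovable Y Z)
  lowestMovable-found Y Z found with search-hit (movable? Y Z) 0 (maxL Y)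
  ... | inj₁ mov = mov , λ j j< → search-miss (movable? Y Z) 0 (maxL Y) j z≤n j<
  ... | inj₂ atEnd = ⊥-elim (<-irrefl refl (subst (λ g → suc g ≤ maxL Y) atEnd (maxL-ub Y found)))

  downClosed : ∀ {Y : List ℕ} r → r ∈ Y → (∀ j → j < r → suc j ∈ Y → j ∈ Y) → ∀ {u} → u ≤ r → u ∈ Y
  downClosed {Y} r r∈ step {u} u≤r = go (r ∸ u) u (m+[n∸m]≡n u≤r)
    where
    go : ∀ n u → u + n ≡ r → u ∈ Y
    go zero u u+0≡r = subst (_∈ Y) (sym (trans (sym (+-identityʳ u)) u+0≡r)) r∈
    go (suc n) u u+n≡r = step u (subst (u <_) u+n≡r (m<m+n u (s≤s z≤n)))
      (go n (suc u) (trans (sym (+-suc u n)) u+n≡r))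

  movable-transfer : ∀ {q Y Z Y′ Z′} → AgreeBelow (suc q) Y Y′ → AgreeBelow (suc q) Z Z′ →
    ∀ {j} → j < q → Movable Y Z j → Movable Y′ Z′ j
  movable-transfer Y≈Y′ Z≈Z′ j<q (sj∈Y , inj₁ sj∈Z) =
    Equivalence.to (Y≈Y′ (s≤s j<q)) sj∈Y , inj₁ (Equivalence.to (Z≈Z′ (s≤s j<q)) sj∈Z)
  movable-transfer Y≈Y′ Z≈Z′ j<q (sj∈Y , inj₂ j∉Y) =
    Equivalence.to (Y≈Y′ (s≤s j<q)) sj∈Y ,
    inj₂ (λ j∈Y′ → j∉Y (Equivalence.from (Y≈Y′ (m<n⇒m<1+n j<q)) j∈Y′))

  noMovable-shape : ∀ {Y Z} → 0 ∈ Y → suc (lowestMovable Y Z) ∉ Y →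
    (∀ {u} → u ≤ maxL Y → u ∈ Y) × (∀ {v} → v ∈ Z → v ≡ 0 ⊎ maxL Y < v)
  noMovable-shape {Y} {Z} 0∈Y none = segment , outside
    where
    stuck : ∀ j → j < maxL Y → ¬ Movable Y Z j
    stuck j j<max with search-hit (movable? Y Z) 0 (maxL Y)
    ... | inj₁ mov = ⊥-elim (none (proj₁ mov))
    ... | inj₂ atEnd = search-miss (movable? Y Z) 0 (maxL Y) j z≤n (subst (j <_) (sym atEnd) j<max)
    segment : ∀ {u} → u ≤ maxL Y → u ∈ Y
    segment = downClosed (maxL Y) (maxL-∈ Y 0∈Y) λ j j<max sj∈Y →
      decidable-stable (j ∈? Y) (λ j∉Y → stuck j j<max (sj∈Y , inj₂ j∉Y))
    outside : ∀ {v} → v ∈ Z → v ≡ 0 ⊎ maxL Y < v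
    outside {zero} _ = inj₁ refl
    outside {suc j} sj∈Z with suc j ≤? maxL Y
    ... | yes sj≤max = ⊥-elim (stuck j sj≤max (segment sj≤max , inj₁ sj∈Z))
    ... | no sj≰max = inj₂ (≰⇒> sj≰max)

  -- Splitting the lowest movable level suc g when it is shared with the other trees:
  -- the first tree keeps level suc g + 1, the other trees keep level suc g.
  module Split {Y Z R g} (cover : Cover Y Z R) (lowest : IsLowestMovable Y Z g) (shared : suc g ∈ Z) where
    open Cover cover

    Y′ Z′ : List ℕ
    Y′ = map (raiseFrom (suc g)) Y
    Z′ = map (raiseFrom (suc (suc g))) Z

    Y′≈Y : AgreeBelow (suc g) Y′ Y
    Y′≈Y = raise-agreeBelow (suc g) Y
    Z′≈Z : AgreeBelow (suc (suc g)) Z′ Z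
    Z′≈Z = raise-agreeBelow (suc (suc g)) Z

    sg∈Y : suc g ∈ Y
    sg∈Y = proj₁ (proj₁ lowest)

    ssg∈Y′ : suc (suc g) ∈ Y′
    ssg∈Y′ = subst (_∈ Y′) (raise-above ≤-refl) (∈-map⁺ _ sg∈Y)

    sg∉Y′ : suc g ∉ Y′
    sg∉Y′ sg∈ = let (u , _ , sg≡) = ∈-map⁻ _ sg∈ in raise-misses (suc g) u (sym sg≡)

    ssg∉Z′ : suc (suc g) ∉ Z′
    ssg∉Z′ ssg∈ = let (u , _ , ssg≡) = ∈-map⁻ _ ssg∈ in raise-misses (suc (suc g)) u (sym ssg≡)

    lowest′ : IsLowestMovable Y′ Z′ (suc g)
    lowest′ = (ssg∈Y′ , inj₂ sg∉Y′) , below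
      where
      below : ∀ j → j < suc g → ¬ Movable Y′ Z′ j
      below j j≤g mov′ with m≤n⇒m<n∨m≡n (≤-pred j≤g)
      ... | inj₂ refl = sg∉Y′ (proj₁ mov′)
      ... | inj₁ j<g = proj₂ lowest j j<g
        (movable-transfer Y′≈Y (AgreeBelow-≤ (n≤1+n _) Z′≈Z) j<g mov′)

    cover′ : Cover Y′ Z′ (suc R)
    cover′ = record { 0∈Y = 0∈Y′ ; Y≤R = bound Y≤R ; Z≤R = bound Z≤R ; covered = covered′ }
      where
      0∈Y′ : 0 ∈ Y′
      0∈Y′ = Equivalence.from (Y′≈Y (s≤s z≤n)) 0∈Y
      bound : ∀ {q V v} → (∀ {u} → u ∈ V → u ≤ R) → v ∈ map (raiseFrom q) V → v ≤ suc R
      bound ≤R v∈ with ∈-map⁻ _ v∈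
      ... | u , u∈ , refl = ≤-trans (raise-≤suc _ u) (s≤s (≤R u∈))
      covered′ : ∀ {j} → suc j ≤ suc R → suc j ∈ Y′ ⊎ suc j ∈ Z′
      covered′ {j} sj≤ with <-cmp j g
      ... | tri≈ _ refl _ = inj₂ (Equivalence.from (Z′≈Z ≤-refl) shared)
      ... | tri< j<g _ _ with covered (≤-trans (m≤n⇒m≤1+n j<g) (Y≤R sg∈Y))
      ...   | inj₁ sj∈Y = inj₁ (Equivalence.from (Y′≈Y (s≤s j<g)) sj∈Y)
      ...   | inj₂ sj∈Z = inj₂ (Equivalence.from (Z′≈Z (s≤s (m<n⇒m<1+n j<g))) sj∈Z)
      covered′ {suc j} sj≤ | tri> _ _ g<sj with covered (≤-pred sj≤)
      ...   | inj₁ sj∈Y = inj₁ (subst (_∈ Y′) (raise-above g<sj) (∈-map⁺ _ sj∈Y))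
      ...   | inj₂ sj∈Z with m≤n⇒m<n∨m≡n g<sj
      ...     | inj₁ sg<sj = inj₂ (subst (_∈ Z′) (raise-above sg<sj) (∈-map⁺ _ sj∈Z))
      ...     | inj₂ refl = inj₁ ssg∈Y′

  -- Merging the lowest movable level suc (suc g) into the unused level suc g below it
  -- (possible when the other trees do not use suc (suc g)).
  module Merge {Y Z R g} (cover : Cover Y Z R) (lowest : IsLowestMovable Y Z (suc g))
    (unshared : suc (suc g) ∉ Z) where
    open Cover cover

    Y′ Z′ : List ℕ
    Y′ = map (lowerFrom (suc (suc g))) Y
    Z′ = map (lowerFrom (suc (suc (suc g)))) Z

    Y′≈Y : AgreeBelow (suc g) Y′ Y
    Y′≈Y = lower-agreeBelow (suc g) Y
    Z′≈Z : AgreeBelow (suc (suc g)) Z′ Z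
    Z′≈Z = lower-agreeBelow (suc (suc g)) Z

    ssg∈Y : suc (suc g) ∈ Y
    ssg∈Y = proj₁ (proj₁ lowest)

    sg∉Y : suc g ∉ Y
    sg∉Y with proj₂ (proj₁ lowest)
    ... | inj₁ ssg∈Z = ⊥-elim (unshared ssg∈Z)
    ... | inj₂ sg∉Y = sg∉Y

    ssg≤R : suc (suc g) ≤ R
    ssg≤R = Y≤R ssg∈Y

    sg∈Z : suc g ∈ Z
    sg∈Z with covered (<⇒≤ ssg≤R)
    ... | inj₁ sg∈Y = ⊥-elim (sg∉Y sg∈Y)
    ... | inj₂ sg∈Z = sg∈Z

    R≡suc : R ≡ suc (pred R)
    R≡suc = sym (suc-pred R {{>-nonZero (<-≤-trans (s≤s z≤n) ssg≤R)}})

    monoY : MonoOn (lowerFrom (suc (suc g))) Y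
    monoY u∈ v∈ = lower-mono (suc g) (λ { refl → sg∉Y u∈ }) (λ { refl → sg∉Y v∈ })

    monoZ : MonoOn (lowerFrom (suc (suc (suc g)))) Z
    monoZ u∈ v∈ = lower-mono (suc (suc g)) (λ { refl → unshared u∈ }) (λ { refl → unshared v∈ })

    sg∈Y′ : suc g ∈ Y′
    sg∈Y′ = subst (_∈ Y′) (lower-above {suc (suc g)} ≤-refl) (∈-map⁺ _ ssg∈Y)

    sg∈Z′ : suc g ∈ Z′
    sg∈Z′ = Equivalence.from (Z′≈Z ≤-refl) sg∈Z

    lowest′ : IsLowestMovable Y′ Z′ g
    lowest′ = (sg∈Y′ , inj₁ sg∈Z′) , λ j j<g mov′ → proj₂ lowest j (m<n⇒m<1+n j<g)
      (movable-transfer Y′≈Y (AgreeBelow-≤ (n≤1+n _) Z′≈Z) j<g mov′)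

    cover′ : Cover Y′ Z′ (pred R)
    cover′ = record { 0∈Y = 0∈Y′ ; Y≤R = boundY ; Z≤R = boundZ ; covered = covered′ }
      where
      0∈Y′ : 0 ∈ Y′
      0∈Y′ = Equivalence.from (Y′≈Y (s≤s z≤n)) 0∈Y
      boundY : ∀ {v} → v ∈ Y′ → v ≤ pred R
      boundY v∈ with ∈-map⁻ _ v∈
      ... | u , u∈ , refl = lower-≤pred (Y≤R u∈) (λ u<ssg → <-≤-trans u<ssg ssg≤R)
      boundZ : ∀ {v} → v ∈ Z′ → v ≤ pred R
      boundZ v∈ with ∈-map⁻ _ v∈
      ... | u , u∈ , refl = lower-≤pred (Z≤R u∈)
        (λ u<sssg → <-≤-trans (≤∧≢⇒< (≤-pred u<sssg) λ { refl → unshared u∈ }) ssg≤R)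
      covered′ : ∀ {j} → suc j ≤ pred R → suc j ∈ Y′ ⊎ suc j ∈ Z′
      covered′ {j} sj≤ with <-cmp j g
      ... | tri≈ _ refl _ = inj₂ sg∈Z′
      ... | tri< j<g _ _ with covered (≤-trans (m≤n⇒m≤1+n (m<n⇒m<1+n j<g)) ssg≤R)
      ...   | inj₁ sj∈Y = inj₁ (Equivalence.from (Y′≈Y (s≤s j<g)) sj∈Y)
      ...   | inj₂ sj∈Z = inj₂ (Equivalence.from (Z′≈Z (s≤s (m<n⇒m<1+n j<g))) sj∈Z)
      covered′ {j} sj≤ | tri> _ _ g<j with covered (subst (suc (suc j) ≤_) (sym R≡suc) (s≤s sj≤))
      ...   | inj₁ ssj∈Y = inj₁ (subst (_∈ Y′) (lower-above (m≤n⇒m≤1+n (s≤s g<j))) (∈-map⁺ _ ssj∈Y))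
      ...   | inj₂ ssj∈Z = inj₂ (subst (_∈ Z′) (lower-above (s≤s (s≤s g<j))) (∈-map⁺ _ ssj∈Z))

  initialSegment⇒noMovable : ∀ {Y Z r} → (∀ {u} → u ≤ r → u ∈ Y) → (∀ {u} → u ∈ Y → u ≤ r) →
    (∀ {v} → v ∈ Z → v ≡ 0 ⊎ r < v) → suc (lowestMovable Y Z) ∉ Y
  initialSegment⇒noMovable {Y} {Z} segment ≤r outside found
    with lowestMovable-found Y Z found
  ... | (sg∈Y , inj₁ sg∈Z) , _ with outside sg∈Z
  ...   | inj₁ ()
  ...   | inj₂ r<sg = <⇒≱ r<sg (≤r sg∈Y)
  initialSegment⇒noMovable {Y} {Z} segment ≤r outside found
      | (sg∈Y , inj₂ g∉Y) , _ = g∉Y (segment (<⇒≤ (≤r sg∈Y)))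

-- Lifts of forest colourings and the sign-reversing involution on them.
module ForestLifts where

  open import Data.Nat using (ℕ; zero; suc; pred; _+_; _∸_; _≤_; _<_; z≤n; s≤s; _≟_; _≤?_)
  open import Data.Nat.Properties
  open import Data.List using (List; _∷_; _++_; map)
  open import Data.List.Membership.Propositional using (_∈_; _∉_)
  open import Data.List.Membership.DecPropositional _≟_ using (_∈?_)
  open import Data.List.Membership.Propositional.Properties using (∈-map⁺; ∈-map⁻; ∈-++⁺ˡ; ∈-++⁺ʳ; ∈-++⁻)
  open import Data.Product using (Σ; _×_; _,_; proj₁; proj₂)
  open import Data.Sum using (_⊎_; inj₁; inj₂)
  open import Data.Empty using (⊥-elim)
  open import Data.Integer using (-_)
  import Data.Integer.Properties as ℤP
  open import Relation.Nullary using (Dec; yes; no)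
  open import Function using (_∘_)
  open import Relation.Binary.PropositionalEquality
  open Levels
  open Colourings
  open LevelSets

  module _ {m : ℕ} where

    lenL : {ts : List (Tree m)} → Cols ts → ℕ
    lenL xs = maxL (cvalsL xs)

    AllLevelsUsed : {ts : List (Tree m)} → Cols ts → Set
    AllLevelsUsed xs = ∀ {j} → suc j ≤ lenL xs → suc j ∈ cvalsL xs

    -- xs is a valid colouring of the forest using all positive levels up to its height,
    -- whose trees project to cs.  These are the colourings below the root in Lemma 3.8.
    Lift : {ts : List (Tree m)} → Cols ts → Cols ts → Set
    Lift cs xs = ValidAll xs × AllLevelsUsed xs × normaliseL xs ≡ cs

    levels-exact : {ts : List (Tree m)} (xs : Cols ts) (R : ℕ) → (∀ {v} → v ∈ cvalsL xs → v ≤ R) →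
      (∀ {j} → suc j ≤ R → suc j ∈ cvalsL xs) → lenL xs ≡ R × AllLevelsUsed xs
    levels-exact xs R ≤R covered = lenL≡R , λ sj≤ → covered (subst (_ ≤_) lenL≡R sj≤)
      where
      top : ∀ R → (∀ {j} → suc j ≤ R → suc j ∈ cvalsL xs) → R ∈ cvalsL xs ⊎ R ≡ 0
      top zero _ = inj₂ refl
      top (suc _) covered = inj₁ (covered ≤-refl)
      lenL≡R : lenL xs ≡ R
      lenL≡R = maxL-exact (cvalsL xs) ≤R (top R covered)

    module FirstTreeInvolution {t : Tree m} {ts : List (Tree m)} where

      recolour₂ : (ℕ → ℕ) → (ℕ → ℕ) → Cols (t ∷ ts) → Cols (t ∷ ts)
      recolour₂ f g (y ∷ xs) = recolour f y ∷ recolourL g xs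

      recolour₂-levels : (P : List ℕ → List ℕ → Set) (f g : ℕ → ℕ) (y : Col t) (xs : Cols ts) →
        P (map f (cvals y)) (map g (cvalsL xs)) → P (cvals (recolour f y)) (cvalsL (recolourL g xs))
      recolour₂-levels P f g y xs = subst₂ P (sym (cvals-recolour f y)) (sym (cvalsL-recolour g xs))

      -- Split the shared level q: the first tree moves to q + 1, the others stay at q.
      split : ℕ → Cols (t ∷ ts) → Cols (t ∷ ts)
      split q = recolour₂ (raiseFrom q) (raiseFrom (suc q))

      -- Merge level q of the first tree into the level q - 1 used only by the others.
      merge : ℕ → Cols (t ∷ ts) → Cols (t ∷ ts)
      merge q = recolour₂ (lowerFrom q) (lowerFrom (suc q))

      actAt : (y : Col t) (xs : Cols ts) (g : ℕ) → Dec (suc g ∈ cvals y) → Dec (suc g ∈ cvalsL xs) →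
        Cols (t ∷ ts)
      actAt y xs g (yes _) (yes _) = split (suc g) (y ∷ xs)
      actAt y xs g (yes _) (no _) = merge (suc g) (y ∷ xs)
      actAt y xs g (no _) _ = y ∷ xs

      ι : Cols (t ∷ ts) → Cols (t ∷ ts)
      ι (y ∷ xs) = actAt y xs g (suc g ∈? cvals y) (suc g ∈? cvalsL xs)
        where
        g : ℕ
        g = lowestMovable (cvals y) (cvalsL xs)

      ι-split : ∀ {y xs g} → lowestMovable (cvals y) (cvalsL xs) ≡ g → suc g ∈ cvals y → suc g ∈ cvalsL xs →
        ι (y ∷ xs) ≡ split (suc g) (y ∷ xs)
      ι-split {y} {xs} {g} refl sg∈Y sg∈Z with suc g ∈? cvals y | suc g ∈? cvalsL xs
      ... | yes _ | yes _ = refl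
      ... | yes _ | no sg∉Z = ⊥-elim (sg∉Z sg∈Z)
      ... | no sg∉Y | _ = ⊥-elim (sg∉Y sg∈Y)

      ι-merge : ∀ {y xs g} → lowestMovable (cvals y) (cvalsL xs) ≡ g → suc g ∈ cvals y → suc g ∉ cvalsL xs →
        ι (y ∷ xs) ≡ merge (suc g) (y ∷ xs)
      ι-merge {y} {xs} {g} refl sg∈Y sg∉Z with suc g ∈? cvals y | suc g ∈? cvalsL xs
      ... | yes _ | yes sg∈Z = ⊥-elim (sg∉Z sg∈Z)
      ... | yes _ | no _ = refl
      ... | no sg∉Y | _ = ⊥-elim (sg∉Y sg∈Y)

      ι-fixed : ∀ {y xs} → suc (lowestMovable (cvals y) (cvalsL xs)) ∉ cvals y → ι (y ∷ xs) ≡ y ∷ xs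
      ι-fixed {y} {xs} none with suc (lowestMovable (cvals y) (cvalsL xs)) ∈? cvals y
      ... | yes found = ⊥-elim (none found)
      ... | no _ = refl

      module Analysis (rt : Reduced t) (c0 : Col t) (cs : Cols ts) where

        cover-of-lift : ∀ {y xs} → Lift (c0 ∷ cs) (y ∷ xs) → Cover (cvals y) (cvalsL xs) (lenL (y ∷ xs))
        cover-of-lift {y} {xs} ((vy , _) , used , _) = record
          { 0∈Y = 0∈cvals y rt vy
          ; Y≤R = λ v∈ → maxL-ub (cvals y ++ cvalsL xs) (∈-++⁺ˡ v∈)
          ; Z≤R = λ v∈ → maxL-ub (cvals y ++ cvalsL xs) (∈-++⁺ʳ (cvals y) v∈)
          ; covered = λ sj≤ → ∈-++⁻ (cvals y) (used sj≤) }

        lift-recolour₂ : ∀ {y xs} (f g : ℕ → ℕ) → f 0 ≡ 0 → g 0 ≡ 0 →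
          MonoOn f (cvals y) → MonoOn g (cvalsL xs) → Lift (c0 ∷ cs) (y ∷ xs) →
          ∀ {R} → Cover (map f (cvals y)) (map g (cvalsL xs)) R →
          Lift (c0 ∷ cs) (recolour₂ f g (y ∷ xs)) × lenL (recolour₂ f g (y ∷ xs)) ≡ R
        lift-recolour₂ {y} {xs} f g f0 g0 monoF monoG ((vy , vxs) , _ , proj≡) {R} cover =
          ((Valid-recolour f f0 y monoF vy , ValidAll-recolour g g0 xs monoG vxs) , proj₂ levels ,
            trans (cong₂ _∷_ (normalise-recolour f y monoF) (normaliseL-recolour g xs monoG)) proj≡) ,
          proj₁ levels
          where
          open Cover (recolour₂-levels (λ A B → Cover A B R) f g y xs cover)
          bounded : ∀ {v} → v ∈ cvalsL (recolour₂ f g (y ∷ xs)) → v ≤ R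
          bounded v∈ with ∈-++⁻ (cvals (recolour f y)) v∈
          ... | inj₁ v∈Y = Y≤R v∈Y
          ... | inj₂ v∈Z = Z≤R v∈Z
          covers : ∀ {j} → suc j ≤ R → suc j ∈ cvalsL (recolour₂ f g (y ∷ xs))
          covers sj≤ with covered sj≤
          ... | inj₁ sj∈Y = ∈-++⁺ˡ sj∈Y
          ... | inj₂ sj∈Z = ∈-++⁺ʳ (cvals (recolour f y)) sj∈Z
          levels : lenL (recolour₂ f g (y ∷ xs)) ≡ R × AllLevelsUsed (recolour₂ f g (y ∷ xs))
          levels = levels-exact (recolour₂ f g (y ∷ xs)) R bounded covers

        lowest-at : ∀ {y : Col t} {xs : Cols ts} {g} → lowestMovable (cvals y) (cvalsL xs) ≡ g → suc g ∈ cvals y →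
          IsLowestMovable (cvals y) (cvalsL xs) g
        lowest-at {y} {xs} refl found = lowestMovable-found (cvals y) (cvalsL xs) found

        record FixedShape (y : Col t) (xs : Cols ts) : Set where
          field
            head≡c0 : y ≡ c0
            restAbove : ∀ {v} → v ∈ cvalsL xs → v ≡ 0 ⊎ len c0 < v
            len≤ : len c0 ≤ lenL (y ∷ xs)

        data Outcome (y : Col t) (xs : Cols ts) : Set where
          moved : Lift (c0 ∷ cs) (ι (y ∷ xs)) → ι (ι (y ∷ xs)) ≡ y ∷ xs →
            sgn (lenL (ι (y ∷ xs))) ≡ - sgn (lenL (y ∷ xs)) → Outcome y xs
          fixed : ι (y ∷ xs) ≡ y ∷ xs → FixedShape y xs → Outcome y xs

        split-outcome : ∀ {y xs g} → Lift (c0 ∷ cs) (y ∷ xs) → lowestMovable (cvals y) (cvalsL xs) ≡ g →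
          suc g ∈ cvals y → suc g ∈ cvalsL xs → Outcome y xs
        split-outcome {y} {xs} {g} lift lowest≡ sg∈Y sg∈Z =
          moved (subst (Lift (c0 ∷ cs)) (sym ιx≡) (proj₁ lifted))
            (trans (cong ι ιx≡) (trans ιx′≡ back))
            (cong sgn (trans (cong lenL ιx≡) (proj₂ lifted)))
          where
          open Split (cover-of-lift {y} {xs} lift) (lowest-at {y} {xs} lowest≡ sg∈Y) sg∈Z
            using (lowest′; cover′; ssg∈Y′; ssg∉Z′)
          ιx≡ : ι (y ∷ xs) ≡ split (suc g) (y ∷ xs)
          ιx≡ = ι-split lowest≡ sg∈Y sg∈Z
          lifted : Lift (c0 ∷ cs) (split (suc g) (y ∷ xs)) ×
                   lenL (split (suc g) (y ∷ xs)) ≡ suc (lenL (y ∷ xs))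
          lifted = lift-recolour₂ (raiseFrom (suc g)) (raiseFrom (suc (suc g)))
            (raise-below {suc g} (s≤s z≤n)) (raise-below {suc (suc g)} (s≤s z≤n))
            (λ _ _ → raise-mono _) (λ _ _ → raise-mono _)
            lift cover′
          ιx′≡ : ι (split (suc g) (y ∷ xs)) ≡ merge (suc (suc g)) (split (suc g) (y ∷ xs))
          ιx′≡ = ι-merge
            (lowestMovable-unique (recolour₂-levels (λ A B → IsLowestMovable A B (suc g)) _ _ y xs lowest′))
            (subst (suc (suc g) ∈_) (sym (cvals-recolour _ y)) ssg∈Y′)
            (subst (suc (suc g) ∉_) (sym (cvalsL-recolour _ xs)) ssg∉Z′)
          back : merge (suc (suc g)) (split (suc g) (y ∷ xs)) ≡ y ∷ xs
          back = cong₂ _∷_ (recolour-inverse _ _ y (λ _ → lower-raise (suc g) _))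
                           (recolourL-inverse _ _ xs (λ _ → lower-raise (suc (suc g)) _))

        merge-outcome : ∀ {y xs g} → Lift (c0 ∷ cs) (y ∷ xs) → lowestMovable (cvals y) (cvalsL xs) ≡ suc g →
          suc (suc g) ∈ cvals y → suc (suc g) ∉ cvalsL xs → Outcome y xs
        merge-outcome {y} {xs} {g} lift lowest≡ ssg∈Y ssg∉Z =
          moved (subst (Lift (c0 ∷ cs)) (sym ιx≡) (proj₁ lifted))
            (trans (cong ι ιx≡) (trans ιx′≡ back))
            sign
          where
          open Merge (cover-of-lift {y} {xs} lift) (lowest-at {y} {xs} lowest≡ ssg∈Y) ssg∉Z
            using (lowest′; cover′; sg∈Y′; sg∈Z′; sg∉Y; monoY; monoZ; R≡suc)
          ιx≡ : ι (y ∷ xs) ≡ merge (suc (suc g)) (y ∷ xs)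
          ιx≡ = ι-merge lowest≡ ssg∈Y ssg∉Z
          lifted : Lift (c0 ∷ cs) (merge (suc (suc g)) (y ∷ xs)) ×
                   lenL (merge (suc (suc g)) (y ∷ xs)) ≡ pred (lenL (y ∷ xs))
          lifted = lift-recolour₂ (lowerFrom (suc (suc g))) (lowerFrom (suc (suc (suc g))))
            (lower-below {suc (suc g)} (s≤s z≤n)) (lower-below {suc (suc (suc g))} (s≤s z≤n)) monoY monoZ
            lift cover′
          sign : sgn (lenL (ι (y ∷ xs))) ≡ - sgn (lenL (y ∷ xs))
          sign = begin
            sgn (lenL (ι (y ∷ xs)))   ≡⟨ cong sgn (trans (cong lenL ιx≡) (proj₂ lifted)) ⟩
            sgn (pred R)              ≡⟨ sym (ℤP.neg-involutive _) ⟩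
            - sgn (suc (pred R))      ≡⟨ cong (-_ ∘ sgn) (sym R≡suc) ⟩
            - sgn R                   ∎
            where
            open ≡-Reasoning
            R : ℕ
            R = lenL (y ∷ xs)
          ιx′≡ : ι (merge (suc (suc g)) (y ∷ xs)) ≡ split (suc g) (merge (suc (suc g)) (y ∷ xs))
          ιx′≡ = ι-split
            (lowestMovable-unique (recolour₂-levels (λ A B → IsLowestMovable A B g) _ _ y xs lowest′))
            (subst (suc g ∈_) (sym (cvals-recolour _ y)) sg∈Y′)
            (subst (suc g ∈_) (sym (cvalsL-recolour _ xs)) sg∈Z′)
          back : split (suc g) (merge (suc (suc g)) (y ∷ xs)) ≡ y ∷ xs
          back = cong₂ _∷_
            (recolour-inverse _ _ y (λ v∈ → raise-lower (suc g) _ λ { refl → sg∉Y v∈ }))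
            (recolourL-inverse _ _ xs (λ v∈ → raise-lower (suc (suc g)) _ λ { refl → ssg∉Z v∈ }))

        -- Without a movable level the first tree carries exactly the levels 0, …, |y|,
        -- so it is normalised and hence equals c0.
        fixed-outcome : ∀ {y xs} → Lift (c0 ∷ cs) (y ∷ xs) →
          suc (lowestMovable (cvals y) (cvalsL xs)) ∉ cvals y → Outcome y xs
        fixed-outcome {y} {xs} lift@(_ , _ , proj≡) none = fixed (ι-fixed none) record
          { head≡c0 = y≡c0
          ; restAbove = subst (λ r → ∀ {v} → v ∈ cvalsL xs → v ≡ 0 ⊎ r < v) (cong len y≡c0) restAbove
          ; len≤ = subst (_≤ lenL (y ∷ xs)) (cong len y≡c0)
              (maxL-ub (cvals y ++ cvalsL xs) (∈-++⁺ˡ (maxL-∈ (cvals y) 0∈Y))) }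
          where
          open Cover (cover-of-lift {y} {xs} lift) using (0∈Y)
          segment : ∀ {u} → u ≤ len y → u ∈ cvals y
          segment = proj₁ (noMovable-shape {cvals y} {cvalsL xs} 0∈Y none)
          restAbove : ∀ {v} → v ∈ cvalsL xs → v ≡ 0 ⊎ len y < v
          restAbove = proj₂ (noMovable-shape {cvals y} {cvalsL xs} 0∈Y none)
          y≡c0 : y ≡ c0
          y≡c0 = trans (sym (normalise-initialSegment y (len y) (maxL-ub (cvals y)) segment))
                       (cong (λ { (c ∷ _) → c }) proj≡)

        analyse : ∀ y xs → Lift (c0 ∷ cs) (y ∷ xs) → Outcome y xs
        analyse y xs lift with suc (lowestMovable (cvals y) (cvalsL xs)) ∈? cvals y
        ... | no none = fixed-outcome lift none
        ... | yes found with suc (lowestMovable (cvals y) (cvalsL xs)) ∈? cvalsL xs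
        ...   | yes shared = split-outcome lift refl found shared
        ...   | no unshared = merge-case refl found unshared
          where
          -- The level below a merged level is unused by the first tree, so it is not 0.
          merge-case : ∀ {g} → lowestMovable (cvals y) (cvalsL xs) ≡ g → suc g ∈ cvals y → suc g ∉ cvalsL xs →
            Outcome y xs
          merge-case {suc g} lowest≡ ssg∈Y ssg∉Z = merge-outcome lift lowest≡ ssg∈Y ssg∉Z
          merge-case {zero} lowest≡ 1∈Y 1∉Z with proj₁ (lowest-at {y} {xs} lowest≡ 1∈Y)
          ... | _ , inj₁ 1∈Z = ⊥-elim (1∉Z 1∈Z)
          ... | _ , inj₂ 0∉Y = ⊥-elim (0∉Y (Cover.0∈Y (cover-of-lift {y} {xs} lift)))

        -- The fixed points correspond to the lifts of cs: drop the first tree (which is c0)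
        -- and move the other trees down by the height r0 of c0.
        r0 : ℕ
        r0 = len c0

        τ : Cols (t ∷ ts) → Cols ts
        τ (_ ∷ xs) = recolourL (_∸ r0) xs

        τ-lift : ∀ {y xs} → Lift (c0 ∷ cs) (y ∷ xs) → FixedShape y xs →
          Lift cs (τ (y ∷ xs)) × lenL (y ∷ xs) ≡ r0 + lenL (τ (y ∷ xs))
        τ-lift {y} {xs} lift@((_ , vxs) , _ , proj≡) shape =
          (ValidAll-recolour (_∸ r0) (0∸n≡0 r0) xs mono vxs , proj₂ levels ,
            trans (normaliseL-recolour (_∸ r0) xs mono) (cong (λ { (_ ∷ ds) → ds }) proj≡)) ,
          sym (trans (cong (r0 +_) (proj₁ levels)) (m+[n∸m]≡n len≤))
          where
          open FixedShape shape
          open Cover (cover-of-lift {y} {xs} lift)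
          R : ℕ
          R = lenL (y ∷ xs)
          Y≤r0 : ∀ {v} → v ∈ cvals y → v ≤ r0
          Y≤r0 v∈ = subst (λ c → _ ≤ len c) head≡c0 (maxL-ub (cvals y) v∈)
          mono : MonoOn (_∸ r0) (cvalsL xs)
          mono {u} {v} u∈ v∈ u<v with restAbove u∈ | restAbove v∈
          ... | _ | inj₁ refl = ⊥-elim (n≮0 u<v)
          ... | inj₁ refl | inj₂ r0<v = subst (_< v ∸ r0) (sym (0∸n≡0 r0)) (m<n⇒0<n∸m r0<v)
          ... | inj₂ r0<u | inj₂ _ = ∸-monoˡ-< u<v (<⇒≤ r0<u)
          image : ∀ {v} → v ∈ cvalsL (recolourL (_∸ r0) xs) → Σ ℕ λ u → u ∈ cvalsL xs × v ≡ u ∸ r0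
          image v∈ = ∈-map⁻ (_∸ r0) (subst (_ ∈_) (cvalsL-recolour (_∸ r0) xs) v∈)
          bounded : ∀ {v} → v ∈ cvalsL (recolourL (_∸ r0) xs) → v ≤ R ∸ r0
          bounded v∈ with image v∈
          ... | u , u∈ , refl = ∸-monoˡ-≤ r0 (Z≤R u∈)
          covers : ∀ {j} → suc j ≤ R ∸ r0 → suc j ∈ cvalsL (recolourL (_∸ r0) xs)
          covers {j} sj≤ with covered {r0 + j} (subst (_≤ R) (+-suc r0 j)
                                (subst (r0 + suc j ≤_) (m+[n∸m]≡n len≤) (+-monoʳ-≤ r0 sj≤)))
          ... | inj₁ ∈Y = ⊥-elim (<⇒≱ (s≤s (m≤m+n r0 j)) (Y≤r0 ∈Y))
          ... | inj₂ ∈Z = subst (_ ∈_) (sym (cvalsL-recolour (_∸ r0) xs))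
            (subst (_∈ map (_∸ r0) (cvalsL xs)) (trans (cong (_∸ r0) (sym (+-suc r0 j))) (m+n∸m≡n r0 (suc j)))
              (∈-map⁺ (_∸ r0) ∈Z))
          levels : lenL (τ (y ∷ xs)) ≡ R ∸ r0 × AllLevelsUsed (τ (y ∷ xs))
          levels = levels-exact (τ (y ∷ xs)) (R ∸ r0) bounded covers

        τ-injective : ∀ {y₁ xs₁ y₂ xs₂} → FixedShape y₁ xs₁ → FixedShape y₂ xs₂ →
          τ (y₁ ∷ xs₁) ≡ τ (y₂ ∷ xs₂) → y₁ ∷ xs₁ ≡ y₂ ∷ xs₂
        τ-injective {xs₁ = xs₁} {xs₂ = xs₂} shape₁ shape₂ τ≡ =
          cong₂ _∷_ (trans (FixedShape.head≡c0 shape₁) (sym (FixedShape.head≡c0 shape₂)))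
            (trans (sym (unτ xs₁ (FixedShape.restAbove shape₁)))
              (trans (cong (recolourL (liftAbove r0)) τ≡) (unτ xs₂ (FixedShape.restAbove shape₂))))
          where
          unτ : (xs : Cols ts) → (∀ {v} → v ∈ cvalsL xs → v ≡ 0 ⊎ r0 < v) →
            recolourL (liftAbove r0) (recolourL (_∸ r0) xs) ≡ xs
          unτ xs above = recolourL-inverse (_∸ r0) (liftAbove r0) xs (λ v∈ → ∸-liftAbove r0 _ (above v∈))

        module Preimage (gf : GapFree c0) {z : Cols ts} (lift : Lift cs z) where

          x : Cols (t ∷ ts)
          x = c0 ∷ recolourL (liftAbove r0) z

          c0-segment : ∀ {u} → u ≤ r0 → u ∈ cvals c0
          c0-segment {u} u≤ = proj₂ (proj₂ (proj₂ gf)) u (subst (u ≤_) (gapFree-len c0 _ (proj₂ gf)) u≤)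

          c0≤r0 : ∀ {u} → u ∈ cvals c0 → u ≤ r0
          c0≤r0 = maxL-ub (cvals c0)

          restAbove : ∀ {v} → v ∈ cvalsL (recolourL (liftAbove r0) z) → v ≡ 0 ⊎ r0 < v
          restAbove v∈ with ∈-map⁻ (liftAbove r0) (subst (_ ∈_) (cvalsL-recolour (liftAbove r0) z) v∈)
          ... | u , _ , refl = liftAbove-range r0 u

          bounded : ∀ {v} → v ∈ cvalsL x → v ≤ r0 + lenL z
          bounded v∈ with ∈-++⁻ (cvals c0) v∈
          ... | inj₁ v∈c0 = ≤-trans (c0≤r0 v∈c0) (m≤m+n r0 _)
          ... | inj₂ v∈rest with ∈-map⁻ (liftAbove r0) (subst (_ ∈_) (cvalsL-recolour (liftAbove r0) z) v∈rest)
          ...   | u , u∈ , refl = ≤-trans (liftAbove-≤ r0 u) (+-monoʳ-≤ r0 (maxL-ub (cvalsL z) u∈))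

          covers : ∀ {j} → suc j ≤ r0 + lenL z → suc j ∈ cvalsL x
          covers {j} sj≤ with suc j ≤? r0
          ... | yes sj≤r0 = ∈-++⁺ˡ (c0-segment sj≤r0)
          ... | no sj≰r0 = ∈-++⁺ʳ (cvals c0) (subst (_ ∈_) (sym (cvalsL-recolour (liftAbove r0) z))
              (subst (_∈ map (liftAbove r0) (cvalsL z)) lifted (∈-map⁺ (liftAbove r0) k∈z)))
            where
            r0≤j : r0 ≤ j
            r0≤j = ≤-pred (≰⇒> sj≰r0)
            k∈z : suc (j ∸ r0) ∈ cvalsL z
            k∈z = proj₁ (proj₂ lift) (subst (_≤ lenL z) (+-∸-assoc 1 r0≤j)
              (subst (suc j ∸ r0 ≤_) (m+n∸m≡n r0 (lenL z)) (∸-monoˡ-≤ r0 sj≤)))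
            lifted : liftAbove r0 (suc (j ∸ r0)) ≡ suc j
            lifted = trans (+-suc r0 (j ∸ r0)) (cong suc (m+[n∸m]≡n r0≤j))

          lift-x : Lift (c0 ∷ cs) x
          lift-x =
            (proj₁ (proj₂ gf) , ValidAll-recolour (liftAbove r0) refl z (λ _ _ → liftAbove-mono r0) (proj₁ lift)) ,
            proj₂ (levels-exact x (r0 + lenL z) bounded covers) ,
            cong₂ _∷_ (gapFree-normalise c0 gf)
              (trans (normaliseL-recolour (liftAbove r0) z (λ _ _ → liftAbove-mono r0)) (proj₂ (proj₂ lift)))

          fixed-x : ι x ≡ x
          fixed-x = ι-fixed (initialSegment⇒noMovable c0-segment c0≤r0 restAbove)

          τ-x : τ x ≡ z
          τ-x = recolourL-inverse (liftAbove r0) (_∸ r0) z (λ _ → liftAbove-∸ r0 _)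

module ForestSum where

  open import Data.Nat using (ℕ; zero; suc; _+_)
  open import Data.List using (List; []; _∷_; map; filter)
  open import Data.List.Relation.Unary.Any using (here)
  open import Data.List.Relation.Unary.Unique.Propositional using (Unique)
  import Data.List.Relation.Unary.AllPairs as AllPairs
  import Data.List.Relation.Unary.All as All
  import Data.List.Relation.Unary.Unique.Propositional.Properties as Unique
  open import Data.List.Membership.Propositional using (_∈_)
  open import Data.List.Membership.Propositional.Properties using (∈-map⁺; ∈-map⁻; ∈-filter⁺; ∈-filter⁻)
  open import Data.Product using (_×_; _,_; proj₁; proj₂)
  open import Data.Empty using (⊥-elim)
  open import Data.Unit using (tt)
  open import Data.Integer as ℤ using (ℤ; -_; 0ℤ)
  import Data.Integer.Properties as ℤP
  open import Function using (_∘_)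
  open import Function.Bundles using (_⇔_; mk⇔; Equivalence)
  open import Relation.Binary.PropositionalEquality
  open SignedSums
  open Colourings
  open ForestLifts

  sgn-+ : ∀ a b → sgn (a + b) ≡ sgn a ℤ.* sgn b
  sgn-+ zero b = sym (ℤP.*-identityˡ (sgn b))
  sgn-+ (suc a) b = trans (cong -_ (sgn-+ a b)) (ℤP.neg-distribˡ-* (sgn a) (sgn b))

  sgn≢-sgn : ∀ k → sgn k ≢ - sgn k
  sgn≢-sgn k eq = sgn≢0 k (self-neg⇒0 (sgn k) eq)
    where
    sgn≢0 : ∀ k → sgn k ≢ 0ℤ
    sgn≢0 zero ()
    sgn≢0 (suc k) sk≡0 = sgn≢0 k (trans (sym (ℤP.neg-involutive (sgn k))) (cong -_ sk≡0))

  module _ {m : ℕ} where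

    forestSum : (ts : List (Tree m)) → ReducedL ts → (cs : Cols ts) → AllGapFree cs →
      (L : List (Cols ts)) → Unique L → (∀ xs → xs ∈ L ⇔ Lift cs xs) →
      sumOf (sgn ∘ lenL) L ≡ signProd cs
    forestSum [] _ [] _ L !L members =
      sumOf-sameMembers (sgn ∘ lenL) !L (All.[] AllPairs.∷ AllPairs.[])
        λ { [] → mk⇔ (λ _ → here refl) (λ _ → Equivalence.from (members []) lift[]) }
      where
      lift[] : Lift [] []
      lift[] = tt , (λ ()) , refl
    forestSum (t ∷ ts) (rt , rts) (c0 ∷ cs) (gf , gfs) L !L members = begin
        sumOf w L
          ≡⟨ sum-fixedPoints L !L closed invol flip ⟩
        sumOf w F
          ≡⟨ sumOf-cong F (λ x∈ → trans (cong sgn (proj₂ (τ-lift-F x∈))) (sgn-+ r0 _)) ⟩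
        sumOf (λ x → sgn r0 ℤ.* sgn (lenL (τ x))) F
          ≡⟨ sumOf-scale (sgn r0) (sgn ∘ lenL ∘ τ) F ⟩
        sgn r0 ℤ.* sumOf (sgn ∘ lenL ∘ τ) F
          ≡⟨ cong (sgn r0 ℤ.*_) (sym (sumOf-map (sgn ∘ lenL) τ F)) ⟩
        sgn r0 ℤ.* sumOf (sgn ∘ lenL) (map τ F)
          ≡⟨ cong (sgn r0 ℤ.*_) (forestSum ts rts cs gfs (map τ F) !τF τF-members) ⟩
        sgn r0 ℤ.* signProd cs
          ∎
      where
      open ≡-Reasoning
      open FirstTreeInvolution {m} {t} {ts}
      open Analysis rt c0 cs
      w : Cols (t ∷ ts) → ℤ
      w = sgn ∘ lenL
      open SignReversingInvolution _≟Cols_ w ι using (fixed?; sum-fixedPoints)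

      lift-of : ∀ {x} → x ∈ L → Lift (c0 ∷ cs) x
      lift-of {x} = Equivalence.to (members x)

      outcome : ∀ {y xs} → y ∷ xs ∈ L → Outcome y xs
      outcome {y} {xs} x∈ = analyse y xs (lift-of x∈)

      closed : ∀ {x} → x ∈ L → ι x ∈ L
      closed {y ∷ xs} x∈ with outcome x∈
      ... | moved lift _ _ = Equivalence.from (members _) lift
      ... | fixed ιx≡x _ = subst (_∈ L) (sym ιx≡x) x∈

      invol : ∀ {x} → x ∈ L → ι (ι x) ≡ x
      invol {y ∷ xs} x∈ with outcome x∈
      ... | moved _ ιιx≡x _ = ιιx≡x
      ... | fixed ιx≡x _ = trans (cong ι ιx≡x) ιx≡x

      flip : ∀ {x} → x ∈ L → ι x ≢ x → w (ι x) ≡ - w x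
      flip {y ∷ xs} x∈ ιx≢x with outcome x∈
      ... | moved _ _ sign = sign
      ... | fixed ιx≡x _ = ⊥-elim (ιx≢x ιx≡x)

      F : List (Cols (t ∷ ts))
      F = filter fixed? L

      inF : ∀ {x} → x ∈ F → x ∈ L × ι x ≡ x
      inF = ∈-filter⁻ fixed? {xs = L}

      shape-of : ∀ {y xs} → y ∷ xs ∈ F → FixedShape y xs
      shape-of {y} {xs} x∈F with inF x∈F
      ... | x∈ , ιx≡x with outcome x∈
      ...   | moved _ _ sign = ⊥-elim (sgn≢-sgn (lenL (y ∷ xs)) (trans (sym (cong w ιx≡x)) sign))
      ...   | fixed _ shape = shape

      τ-lift-F : ∀ {x} → x ∈ F → Lift cs (τ x) × lenL x ≡ r0 + lenL (τ x)
      τ-lift-F {y ∷ xs} x∈F = τ-lift (lift-of (proj₁ (inF x∈F))) (shape-of x∈F)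

      !τF : Unique (map τ F)
      !τF = map-unique τ F (Unique.filter⁺ fixed? !L) injective
        where
        injective : ∀ {x₁ x₂} → x₁ ∈ F → x₂ ∈ F → τ x₁ ≡ τ x₂ → x₁ ≡ x₂
        injective {_ ∷ _} {_ ∷ _} x₁∈ x₂∈ = τ-injective (shape-of x₁∈) (shape-of x₂∈)

      τF-members : ∀ z → z ∈ map τ F ⇔ Lift cs z
      τF-members z = mk⇔ to from
        where
        to : z ∈ map τ F → Lift cs z
        to z∈ with ∈-map⁻ τ z∈
        ... | x , x∈ , refl = proj₁ (τ-lift-F x∈)
        from : Lift cs z → z ∈ map τ F
        from lift = subst (_∈ map τ F) τ-x
          (∈-map⁺ τ (∈-filter⁺ fixed? (Equivalence.from (members x) lift-x) fixed-x))
          where open Preimage gf lift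

-- Colourings of node ts in 𝒞_T correspond to lifts of cs.
module RootedColourings where

  open import Data.Nat using (ℕ; zero; suc; _≤_; _<_; z≤n; s≤s; _≟_)
  open import Data.Nat.Properties
  open import Data.Fin using (Fin)
  open import Data.List using (List; []; _∷_; map)
  open import Data.List.Relation.Unary.All as All using (All; []; _∷_)
  import Data.List.Relation.Unary.All.Properties as All
  open import Data.List.Relation.Unary.Any using (Any; here; there)
  import Data.List.Relation.Unary.Any.Properties as Any
  open import Data.List.Relation.Unary.Unique.Propositional using (Unique)
  open import Data.List.Membership.Propositional using (_∈_)
  open import Data.List.Membership.Propositional.Properties using (∈-map⁺; ∈-map⁻; ∈-++⁺ˡ; ∈-++⁺ʳ; ∈-++⁻)
  open import Data.Product using (_×_; _,_; proj₁; proj₂)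
  open import Data.Sum using (inj₁; inj₂)
  open import Data.Empty using (⊥-elim)
  open import Data.Unit using (tt)
  open import Data.Integer as ℤ using (-_)
  open import Function using (_∘_)
  open import Function.Bundles using (_⇔_; mk⇔; Equivalence)
  open import Relation.Nullary using (yes; no)
  open import Relation.Binary.PropositionalEquality
  open SignedSums
  open Levels
  open Colourings
  open ForestLifts
  open ForestSum

  module _ {m : ℕ} where

    children : {ts : List (Tree m)} → Col (node ts) → Cols ts
    children (cnode _ xs) = xs

    rooted : {ts : List (Tree m)} → Cols ts → Col (node ts)
    rooted xs = cnode (suc (lenL xs)) xs

    ValidL⇒ValidAll : ∀ {k} {ts : List (Tree m)} (xs : Cols ts) → ValidL k xs → ValidAll xs
    ValidL⇒ValidAll [] _ = tt
    ValidL⇒ValidAll (x ∷ xs) (_ , vx , vxs) = vx , ValidL⇒ValidAll xs vxs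

    ValidAll⇒ValidL : ∀ {k} {ts : List (Tree m)} (xs : Cols ts) → ValidAll xs →
      (∀ {v} → v ∈ cvalsL xs → v < k) → ValidL k xs
    ValidAll⇒ValidL [] _ _ = tt
    ValidAll⇒ValidL (x ∷ xs) (vx , vxs) <k =
      <k (∈-++⁺ˡ (colour∈cvals x)) , vx , ValidAll⇒ValidL xs vxs (<k ∘ ∈-++⁺ʳ (cvals x))

    gapFree-rooted : {ts : List (Tree m)} → Reduced (node ts) → (c : Col (node ts)) → GapFree c →
      ValidAll (children c) × AllLevelsUsed (children c) × c ≡ rooted (children c)
    gapFree-rooted {[]} (() , _) _ _
    gapFree-rooted {_ ∷ _} _ (cnode zero (x ∷ xs)) (_ , (x<0 , _) , _) = ⊥-elim (n≮0 x<0)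
    gapFree-rooted {_ ∷ _} _ (cnode (suc k) xs) (r , valid , ≤r , uses) =
      ValidL⇒ValidAll xs valid , proj₂ levels , cong (λ h → cnode (suc h) xs) (sym (proj₁ levels))
      where
      k<r : k < r
      k<r = All.lookup ≤r (here refl)
      covers : ∀ {j} → suc j ≤ k → suc j ∈ cvalsL xs
      covers {j} sj≤k with uses (suc j) (≤-trans sj≤k (<⇒≤ k<r))
      ... | here sj≡sk = ⊥-elim (<-irrefl sj≡sk (s≤s sj≤k))
      ... | there sj∈ = sj∈
      levels : lenL xs ≡ k × AllLevelsUsed xs
      levels = levels-exact xs k (λ v∈ → ≤-pred (ValidL-<root (suc k) xs valid v∈)) covers

    len-rooted : {ts : List (Tree m)} (xs : Cols ts) → len (rooted xs) ≡ suc (lenL xs)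
    len-rooted xs = m≥n⇒m⊔n≡m (n≤1+n (lenL xs))

    rooted-gapFree : {ts : List (Tree m)} → Reduced (node ts) → (xs : Cols ts) → ValidAll xs →
      AllLevelsUsed xs → GapFreeOfLength (suc (lenL xs)) (rooted xs)
    rooted-gapFree {t ∷ _} (_ , rt , _) (x ∷ xs) valid used =
      ValidAll⇒ValidL (x ∷ xs) valid (s≤s ∘ maxL-ub _) ,
      ≤-refl ∷ All.tabulate (m≤n⇒m≤1+n ∘ maxL-ub _) ,
      uses
      where
      uses : ∀ j → j ≤ suc (lenL (x ∷ xs)) → j ∈ cvals (rooted (x ∷ xs))
      uses zero _ = there (∈-++⁺ˡ (0∈cvals x rt (proj₁ valid)))
      uses (suc j) sj≤ with m≤n⇒m<n∨m≡n sj≤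
      ... | inj₁ sj≤len = there (used (≤-pred sj≤len))
      ... | inj₂ refl = here refl

    module _ {n : ℕ} (cls : Fin m → Fin n) where

      -- A valid colouring of a reduced tree gives colour 0 exactly to the leaves,
      -- so every vertex of colour 1 has only leaf children.
      colour0⇒leaf : {t : Tree m} (c : Col t) → Reduced t → Valid c → colour c ≡ 0 → IsLeaf t
      colour0⇒leaf (cleaf _) _ _ _ = tt
      colour0⇒leaf (cnode k (x ∷ xs)) _ (x<k , _) refl = ⊥-elim (n≮0 x<k)
      colour0⇒leaf (cnode k []) (() , _) _ _

      below1⇒leaves : {ts : List (Tree m)} (xs : Cols ts) → ReducedL ts → ValidL 1 xs → All IsLeaf ts
      below1⇒leaves [] _ _ = []
      below1⇒leaves (x ∷ xs) (rx , rxs) (x<1 , vx , vxs) =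
        colour0⇒leaf x rx vx (n<1⇒n≡0 x<1) ∷ below1⇒leaves xs rxs vxs

      ColourOneMixing : ℕ × List (Fin m) → Set
      ColourOneMixing (k , labels) = k ≡ 1 × TwoClasses cls labels

      mutual
        mixing-colour1 : {t : Tree m} (c : Col t) → Reduced t → Valid c → Mixing cls t →
          1 ∈ cvals c → Any ColourOneMixing (nodeData c)
        mixing-colour1 (cleaf k) _ k≡0 _ (here 1≡k) = ⊥-elim (1+n≢0 (trans 1≡k k≡0))
        mixing-colour1 (cnode k xs) (_ , rxs) valid (mix ∷ mixes) 1∈ with k ≟ 1
        ... | yes refl = here (refl , mix (below1⇒leaves xs rxs valid))
        ... | no k≢1 with 1∈
        ...   | here 1≡k = ⊥-elim (k≢1 (sym 1≡k))
        ...   | there 1∈xs = there (mixing-colour1L xs rxs valid mixes 1∈xs)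

        mixing-colour1L : {ts : List (Tree m)} {k : ℕ} (xs : Cols ts) → ReducedL ts → ValidL k xs →
          All (λ ts → All IsLeaf ts → TwoClasses cls (leafChildren ts)) (internalsL ts) →
          1 ∈ cvalsL xs → Any ColourOneMixing (nodeDataL xs)
        mixing-colour1L {t ∷ _} (x ∷ xs) (rx , rxs) (_ , vx , vxs) mixes 1∈ with ∈-++⁻ (cvals x) 1∈
        ... | inj₁ 1∈x = Any.++⁺ˡ (mixing-colour1 x rx vx (All.++⁻ˡ (internals t) mixes) 1∈x)
        ... | inj₂ 1∈xs =
          Any.++⁺ʳ (nodeData x) (mixing-colour1L xs rxs vxs (All.++⁻ʳ (internals t) mixes) 1∈xs)

      InC⇒Lift : {ts : List (Tree m)} {cs : Cols ts} → Reduced (node ts) → (c : Col (node ts)) →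
        InC cls c × projections c ≡ cs → Lift cs (children c) × c ≡ rooted (children c)
      InC⇒Lift red c@(cnode _ _) ((gf , _) , proj≡) =
        let (valid , used , c≡) = gapFree-rooted red c gf in (valid , used , proj≡) , c≡

      Lift⇒InC : {ts : List (Tree m)} {cs : Cols ts} → Reduced (node ts) → Mixing cls (node ts) →
        (xs : Cols ts) → Lift cs xs → InC cls (rooted xs) × projections (rooted xs) ≡ cs
      Lift⇒InC red mix xs (valid , used , proj≡) =
        ((_ , gf) , inj₁ weaklyMixing) , proj≡
        where
        gf : GapFreeOfLength (suc (lenL xs)) (rooted xs)
        gf = rooted-gapFree red xs valid used
        weaklyMixing : Any ColourOneMixing (nodeData (rooted xs))
        weaklyMixing = mixing-colour1 (rooted xs) red (proj₁ gf) mix (proj₂ (proj₂ gf) 1 (s≤s z≤n))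

      module ChildrenEnumeration {ts : List (Tree m)} {cs : Cols ts} (red : Reduced (node ts))
        (mix : Mixing cls (node ts)) (L : List (Col (node ts))) (!L : Unique L)
        (members : ∀ c → (c ∈ L) ⇔ (InC cls c × projections c ≡ cs)) where

        lift-of : ∀ {c} → c ∈ L → Lift cs (children c) × c ≡ rooted (children c)
        lift-of {c} c∈ = InC⇒Lift red c (Equivalence.to (members c) c∈)

        len-children : ∀ {c} → c ∈ L → len c ≡ suc (lenL (children c))
        len-children {c} c∈ = trans (cong len (proj₂ (lift-of c∈))) (len-rooted (children c))

        !children : Unique (map children L)
        !children = map-unique children L !L λ c₁∈ c₂∈ children≡ →
          trans (proj₂ (lift-of c₁∈)) (trans (cong rooted children≡) (sym (proj₂ (lift-of c₂∈))))

        children-members : ∀ xs → xs ∈ map children L ⇔ Lift cs xs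
        children-members xs = mk⇔ to
          (λ lift → ∈-map⁺ children (Equivalence.from (members _) (Lift⇒InC red mix xs lift)))
          where
          to : xs ∈ map children L → Lift cs xs
          to xs∈ with ∈-map⁻ children xs∈
          ... | c , c∈ , refl = proj₁ (lift-of c∈)

  signedSum≡sumOf : ∀ {m} {T : Tree m} (L : List (Col T)) → signedSum L ≡ sumOf (sgn ∘ len) L
  signedSum≡sumOf [] = refl
  signedSum≡sumOf (c ∷ L) = cong (ℤ._+_ (sgn (len c))) (signedSum≡sumOf L)

open SignedSums using (sumOf; sumOf-cong; sumOf-neg; sumOf-map)
open ForestLifts using (lenL)
open ForestSum using (forestSum)
open RootedColourings using (children; signedSum≡sumOf; module ChildrenEnumeration)

lemma3p8 : {m n : ℕ} (cls : Fin m → Fin n) (ts : List (Tree m))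
    → Reduced (node ts) → LeafBijective (node ts) → Mixing cls (node ts)
    → 2 ≤ height (node ts)
    → (cs : Cols ts) → AllGapFree cs
    → (L : List (Col (node ts))) → Unique L
    → (∀ c → (c ∈ L) ⇔ (InC cls c × projections c ≡ cs))
    → signedSum L ≡ - signProd cs
lemma3p8 cls ts red _ mix _ cs gfs L !L members = begin
    signedSum L
      ≡⟨ signedSum≡sumOf L ⟩
    sumOf (sgn ∘ len) L
      ≡⟨ sumOf-cong L (cong sgn ∘ len-children) ⟩
    sumOf (λ c → - sgn (lenL (children c))) L
      ≡⟨ sumOf-neg (sgn ∘ lenL ∘ children) L ⟩
    - sumOf (sgn ∘ lenL ∘ children) L
      ≡⟨ cong -_ (sym (sumOf-map (sgn ∘ lenL) children L)) ⟩
    - sumOf (sgn ∘ lenL) (map children L)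
      ≡⟨ cong -_ (forestSum ts (proj₂ red) cs gfs _ !children children-members) ⟩
    - signProd cs
      ∎
  where
  open ≡-Reasoning
  open ChildrenEnumeration cls red mix L !L members
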